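{- Let $L$ be a finite signature, let $\mathfrak{K}_0$ be a class of $L$-structures with domain $\omega$ (closed under isomorphism among structures with domain $\omega$), and let $\nu$ be an effective enumeration of $\mathfrak{K}_0$. Let $\mathfrak{K} = \{\mathcal{B}_i : i\in\omega\}$ be a family with $\mathfrak{K}\subseteq\mathfrak{K}_0$ (together with all isomorphic copies with domain $\omega$), where the structures $\mathcal{B}_i$ are infinite and pairwise non-isomorphic. Then the following are equivalent: (1) the class $\mathfrak{K}$ is $\mathbf{InfEx}_{\cong}[\nu]$-learnable; (2) there is a sequence $(\psi_i)_{i\in\omega}$ of $\Sigma^{\mathrm{inf}}_2$ sentences in the signature $L$ such that for all $i,j\in\omega$, $\mathcal{B}_j\models\psi_i$ if and only if $i=j$.
   Context: Relational signatures: if $L$ has function or constant symbols, they are replaced by their graphs. Let $L=\{P_0^{n_0},\dots,P_k^{n_k}\}$. An $L$-informant is a function $I$ on $\omega$ with $I(m)=(I_0(m),\dots,I_k(m))$, $I_j(m)\in\omega^{n_j}\times\{0,1\}$. $I$ is an informant for the $L$-structure $\mathcal{S}=(\omega;P_0,\dots,P_k)$ if for every $j\le k$, the range of $I_j$ equals $\{(\bar a,1):\bar a\in P_j\}\cup\{(\bar a,0):\bar a\in\omega^{n_j}\setminus P_j\}$. $I[n]$ denotes $I(0),\dots,I(n-1)$. A learner is a function $M$ from finite initial segments of informants to $\omega\cup\{?\}$. An effective enumeration of a class $\mathfrak{K}_0$ is a map $\nu:\omega\to\mathfrak{K}_0$ such that $(\nu(e))_{e\in\omega}$ is a uniformly computable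 sequence of structures and every member of $\mathfrak{K}_0$ is isomorphic to some $\nu(e)$. For $\mathfrak{C}\subseteq\mathfrak{K}_0$ (closed under isomorphism), $\mathfrak{C}$ is $\mathbf{InfEx}_{\cong}[\nu]$-learnable if there is a learner $M$ (no computability required) such that for every $\mathcal{A}\in\mathfrak{C}$ and every informant $I$ for $\mathcal{A}$ there are $e,s_0$ with $\nu(e)\cong\mathcal{A}$ and $M(I[s])=e$ for all $s\ge s_0$. Infinitary formulas: $\Sigma^{\mathrm{inf}}_0=\Pi^{\mathrm{inf}}_0$ are finitary quantifier-free formulas; a $\Sigma^{\mathrm{inf}}_n$ formula $\psi(\bar x)$ is a countable disjunction $\bigvee_{i\in I}\exists\bar y_i\,\xi_i(\bar x,\bar y_i)$ with each $\xi_i$ a $\Pi^{\mathrm{inf}}_{m}$ formula for some $m<n$; a $\Pi^{\mathrm{inf}}_n$ formula is a countable conjunction $\bigwedge_{i\in I}\forall\bar y_i\,\xi_i(\bar x,\bar y_i)$ with each $\xi_i$ a $\Sigma^{\mathrm{inf}}_m$ formula for some $m<n$ (all with finitely many free variables). -}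

module Defs where

open import Data.Nat using (ℕ; zero; suc; _+_; _≤_; _<_)
open import Data.Fin using (Fin; splitAt)
open import Data.Vec using (Vec; []; _∷_; lookup)
import Data.Vec as Vec
open import Data.List using (List; upTo)
import Data.List as List
open import Data.Bool using (Bool; true; false; if_then_else_)
open import Data.Maybe using (Maybe; just; nothing)
open import Data.Product using (Σ; _×_; _,_)
open import Data.Sum using (_⊎_; [_,_])
open import Data.Empty using (⊥)
open import Data.Unit using (⊤)
open import Relation.Nullary using (¬_)
open import Relation.Binary.PropositionalEquality using (_≡_)
open import Function.Bundles using (_↔_; Inverse; _⇔_)

data Rec : ℕ → Set where
  zer  : ∀ {n} → Rec n
  succ : Rec 1
  proj : ∀ {n} → Fin n → Rec n
  comp : ∀ {m n} → Rec m → Vec (Rec n) m → Rec n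
  prim : ∀ {n} → Rec n → Rec (suc (suc n)) → Rec (suc n)
  mu   : ∀ {n} → Rec (suc n) → Rec n

mutual
  data _∙_⇓_ : ∀ {n} → Rec n → Vec ℕ n → ℕ → Set where
    zer-ev  : ∀ {n} {xs : Vec ℕ n} → zer ∙ xs ⇓ 0
    succ-ev : ∀ {x} → succ ∙ (x ∷ []) ⇓ suc x
    proj-ev : ∀ {n} {i : Fin n} {xs} → proj i ∙ xs ⇓ lookup xs i
    comp-ev : ∀ {m n} {f : Rec m} {gs : Vec (Rec n) m} {xs ys y} →
              gs ∙ xs ⇓* ys → f ∙ ys ⇓ y → comp f gs ∙ xs ⇓ y
    prim-z  : ∀ {n} {g : Rec n} {h : Rec (suc (suc n))} {xs y} →
              g ∙ xs ⇓ y → prim g h ∙ (0 ∷ xs) ⇓ y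
    prim-s  : ∀ {n} {g : Rec n} {h : Rec (suc (suc n))} {xs x y z} →
              prim g h ∙ (x ∷ xs) ⇓ y → h ∙ (x ∷ y ∷ xs) ⇓ z →
              prim g h ∙ (suc x ∷ xs) ⇓ z
    mu-ev   : ∀ {n} {f : Rec (suc n)} {xs y} →
              f ∙ (y ∷ xs) ⇓ 0 →
              (∀ z → z < y → Σ ℕ λ w → f ∙ (z ∷ xs) ⇓ suc w) →
              mu f ∙ xs ⇓ y

  data _∙_⇓*_ : ∀ {m n} → Vec (Rec n) m → Vec ℕ n → Vec ℕ m → Set where
    []-ev : ∀ {n} {xs : Vec ℕ n} → [] ∙ xs ⇓* []
    ∷-ev  : ∀ {m n} {g : Rec n} {gs : Vec (Rec n) m} {xs y ys} →
            g ∙ xs ⇓ y → gs ∙ xs ⇓* ys → (g ∷ gs) ∙ xs ⇓* (y ∷ ys)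

record Sig : Set where
  field
    k  : ℕ
    ar : Fin (suc k) → ℕ

Sym : Sig → Set
Sym L = Fin (suc (Sig.k L))

-- L-structures with domain ω (relations given by characteristic functions)
Str : Sig → Set
Str L = (j : Sym L) → Vec ℕ (Sig.ar L j) → Bool

_≅_ : {L : Sig} → Str L → Str L → Set
_≅_ {L} A B = Σ (ℕ ↔ ℕ) λ f →
  (j : Sym L) (a : Vec ℕ (Sig.ar L j)) → A j a ≡ B j (Vec.map (Inverse.to f) a)

ClosedUnderIso : {L : Sig} → (Str L → Set) → Set
ClosedUnderIso {L} K = (A B : Str L) → K A → A ≅ B → K B

UniformlyComputable : {L : Sig} → (ℕ → Str L) → Set
UniformlyComputable {L} ν = (j : Sym L) →
  Σ (Rec (suc (Sig.ar L j))) λ c → (e : ℕ) (a : Vec ℕ (Sig.ar L j)) →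
    c ∙ (e ∷ a) ⇓ (if ν e j a then 1 else 0)

EffectiveEnumeration : {L : Sig} → (Str L → Set) → (ℕ → Str L) → Set
EffectiveEnumeration {L} K0 ν =
  UniformlyComputable ν × ((e : ℕ) → K0 (ν e)) ×
  ((A : Str L) → K0 A → Σ ℕ λ e → ν e ≅ A)

Row : Sig → Set
Row L = (j : Sym L) → Vec ℕ (Sig.ar L j) × Bool

Informant : Sig → Set
Informant L = ℕ → Row L

IsInformantFor : {L : Sig} → Informant L → Str L → Set
IsInformantFor {L} I S = (j : Sym L) (a : Vec ℕ (Sig.ar L j)) (b : Bool) →
  (Σ ℕ λ m → I m j ≡ (a , b)) ⇔ (S j a ≡ b)

_[_] : {L : Sig} → Informant L → ℕ → List (Row L)
I [ n ] = List.map I (upTo n)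

-- learners: arbitrary functions; `nothing` plays the role of '?'
Learner : Sig → Set
Learner L = List (Row L) → Maybe ℕ

InfExLearnable : {L : Sig} → (Str L → Set) → (ℕ → Str L) → Set
InfExLearnable {L} C ν = Σ (Learner L) λ M →
  (A : Str L) → C A → (I : Informant L) → IsInformantFor I A →
  Σ ℕ λ e → Σ ℕ λ s₀ → (ν e ≅ A) × ((s : ℕ) → s₀ ≤ s → M (I [ s ]) ≡ just e)

-- Countable disjunctions/conjunctions are indexed by
-- ℕ, an entry `nothing` meaning "no disjunct/conjunct here" (so finite and
-- empty index sets are covered too).

data QF (L : Sig) (v : ℕ) : Set where
  rel : (j : Sym L) → Vec (Fin v) (Sig.ar L j) → QF L v
  eq  : Fin v → Fin v → QF L v
  neg : QF L v → QF L v
  and : QF L v → QF L v → QF L v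
  or  : QF L v → QF L v → QF L v

mutual
  data SigmaF (L : Sig) : ℕ → ℕ → Set where
    qfΣ : ∀ {v} → QF L v → SigmaF L 0 v
    ⋁∃  : ∀ {n v} → (ℕ → Maybe (Disjunct L n v)) → SigmaF L (suc n) v

  data Disjunct (L : Sig) (n v : ℕ) : Set where
    ∃[_,_,_]_ : (len m : ℕ) → m ≤ n → PiF L m (v + len) → Disjunct L n v

  data PiF (L : Sig) : ℕ → ℕ → Set where
    qfΠ : ∀ {v} → QF L v → PiF L 0 v
    ⋀∀  : ∀ {n v} → (ℕ → Maybe (Conjunct L n v)) → PiF L (suc n) v

  data Conjunct (L : Sig) (n v : ℕ) : Set where
    ∀[_,_,_]_ : (len m : ℕ) → m ≤ n → SigmaF L m (v + len) → Conjunct L n v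

extend : ∀ {v len} → (Fin v → ℕ) → Vec ℕ len → Fin (v + len) → ℕ
extend {v} ρ ys x = [ ρ , lookup ys ] (splitAt v x)

SatQF : ∀ {L v} → Str L → QF L v → (Fin v → ℕ) → Set
SatQF S (rel j xs) ρ = S j (Vec.map ρ xs) ≡ true
SatQF S (eq x y)   ρ = ρ x ≡ ρ y
SatQF S (neg φ)    ρ = ¬ SatQF S φ ρ
SatQF S (and φ ψ)  ρ = SatQF S φ ρ × SatQF S ψ ρ
SatQF S (or φ ψ)   ρ = SatQF S φ ρ ⊎ SatQF S ψ ρ

mutual
  SatΣ : ∀ {L n v} → Str L → SigmaF L n v → (Fin v → ℕ) → Set
  SatΣ S (qfΣ φ) ρ = SatQF S φ ρ
  SatΣ S (⋁∃ ds) ρ = Σ ℕ λ i → SatD S (ds i) ρ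

  SatD : ∀ {L n v} → Str L → Maybe (Disjunct L n v) → (Fin v → ℕ) → Set
  SatD S nothing ρ = ⊥
  SatD S (just (∃[ len , m , _ ] ξ)) ρ =
    Σ (Vec ℕ len) λ ys → SatΠ S ξ (extend ρ ys)

  SatΠ : ∀ {L n v} → Str L → PiF L n v → (Fin v → ℕ) → Set
  SatΠ S (qfΠ φ) ρ = SatQF S φ ρ
  SatΠ S (⋀∀ cs) ρ = (i : ℕ) → SatC S (cs i) ρ

  SatC : ∀ {L n v} → Str L → Maybe (Conjunct L n v) → (Fin v → ℕ) → Set
  SatC S nothing ρ = ⊤
  SatC S (just (∀[ len , m , _ ] ξ)) ρ =
    (ys : Vec ℕ len) → SatΣ S ξ (extend ρ ys)

noVars : Fin 0 → ℕ
noVars ()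

Σ2Sentence : Sig → Set
Σ2Sentence L = SigmaF L 2 0

_⊨_ : ∀ {L} → Str L → Σ2Sentence L → Set
S ⊨ ψ = SatΣ S ψ noVars

GeneratedBy : {L : Sig} → (ℕ → Str L) → Str L → Set
GeneratedBy B A = Σ ℕ λ i → B i ≅ A

LEM : Set₁
LEM = (P : Set) → Dec P
  where open import Relation.Nullary using (Dec)

module Submission where

-- (2) ⇒ (1). Each ψ i is a disjunction of formulas ∃ȳ π(ȳ) with π universal. Enumerate the candidates
-- (i , disjunct , witness tuple); the claim of a candidate is Π₁, so when it is false in the presented
-- structure A, a finite part of any informant for A refutes it. Conjecturing B i for the least candidate
-- not yet refuted, the learner settles on the least candidate true in A, whose i is the right one.
--
-- (1) ⇒ (2). Locking sequences (Blum–Blum): for each i there are finitely many rows τ about distinct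
-- elements ā of B i and a correct conjecture e such that M outputs e after every continuation of τ
-- consistent with B i. Otherwise an informant for a copy of B i, built in stages that each move M off any
-- correct conjecture, defeats M. Now ψ i says "there are distinct x̄ satisfying τ, and no extension of
-- their diagram that moves M off e is realised". B i satisfies it, and if B j does then every informant
-- for B j beginning with τ drives M to e, so B j ≅ ν e ≅ B i.

open import Defs
open import Data.Nat
  using (ℕ; zero; suc; _+_; _≤_; _<_; _≤′_; ≤′-refl; ≤′-step; z≤n; s≤s; s≤s⁻¹; z<s; s<s; _⊔_; _∸_; _<?_; _≟_)
open import Data.Nat.Properties
open import Data.Product using (Σ; _×_; _,_; proj₁; proj₂; uncurry)
open import Data.Product.Function.NonDependent.Propositional using (_×-⇔_)
open import Data.Sum.Function.Propositional using (_⊎-⇔_)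
open import Function.Related.TypeIsomorphisms using (¬-cong-⇔)
import Function.Properties.Equivalence as ⇔
open import Data.Sum using (inj₁; inj₂)
open import Data.Empty using (⊥; ⊥-elim)
open import Data.Unit using (tt)
open import Data.Bool using (Bool; true; false)
import Data.Bool.Properties as BoolP
open import Data.Maybe using (Maybe; just; nothing)
import Data.Maybe as Maybe
import Data.Maybe.Properties as MaybeP
open import Data.List using (List; []; _∷_; _++_; length; upTo; applyUpTo; take; allFin; concatMap)
import Data.List
import Data.List.Properties as ListP
open import Data.List.Relation.Unary.All using (All; []; _∷_)
import Data.List.Relation.Unary.All as All
import Data.List.Relation.Unary.All.Properties as AllP
open import Data.List.Relation.Unary.Any using (here)
open import Data.List.Membership.Propositional using (_∈_)
open import Data.List.Membership.Propositional.Properties using (∈-++⁺ʳ; ∈-allFin; ∈-map⁺; ∈-concat⁺′)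
open import Data.Fin using (Fin; splitAt; toℕ; fromℕ<)
import Data.Fin as Fin
import Data.Fin.Properties as FinP
open import Data.Vec using (Vec; []; _∷_; lookup)
import Data.Vec as Vec
import Data.Vec.Properties as VecP
import Data.Vec.Relation.Unary.All as VAll
open import Relation.Nullary using (¬_; Dec; yes; no)
open import Relation.Nullary.Decidable using (decidable-stable)
open import Relation.Binary.Definitions using (tri<; tri≈; tri>)
open import Induction.WellFounded using (Acc; acc)
open import Data.Nat.Induction using (<-wellFounded)
open import Relation.Binary.PropositionalEquality hiding ([_])
open import Function.Bundles using (_⇔_; _↔_; Inverse; mk⇔; mk↔ₛ′; Equivalence)
open import Function.Properties.Inverse using (↔-refl; ↔-sym; ↔-trans)
open import Function using (_∘_)

-- Isomorphism invariance of satisfaction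

module _ (f : ℕ ↔ ℕ) where
  open Inverse f

  to∘from : ∀ y → to (from y) ≡ y
  to∘from = strictlyInverseˡ

  from∘to : ∀ x → from (to x) ≡ x
  from∘to = strictlyInverseʳ

≅-refl : ∀ {L} {A : Str L} → A ≅ A
≅-refl {A = A} = ↔-refl , λ j a → cong (A j) (sym (VecP.map-id a))

≅-sym : ∀ {L} {A B : Str L} → A ≅ B → B ≅ A
≅-sym {A = A} {B} (f , h) = ↔-sym f , λ j a → sym (begin
  A j (Vec.map from a)              ≡⟨ h j (Vec.map from a) ⟩
  B j (Vec.map to (Vec.map from a)) ≡⟨ cong (B j) (VecP.map-∘ to from a) ⟨
  B j (Vec.map (to ∘ from) a)       ≡⟨ cong (B j) (VecP.map-cong (to∘from f) a) ⟩
  B j (Vec.map (λ x → x) a)         ≡⟨ cong (B j) (VecP.map-id a) ⟩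
  B j a ∎)
  where open ≡-Reasoning; open Inverse f

≅-trans : ∀ {L} {A B C : Str L} → A ≅ B → B ≅ C → A ≅ C
≅-trans {C = C} (f , h) (g , h′) = ↔-trans f g , λ j a →
  trans (h j a) (trans (h′ j _) (cong (C j) (sym (VecP.map-∘ _ _ a))))

Tracks : ∀ {v} → ℕ ↔ ℕ → (Fin v → ℕ) → (Fin v → ℕ) → Set
Tracks f ρ ρ′ = ∀ x → ρ′ x ≡ Inverse.to f (ρ x)

Tracks-sym : ∀ {v} f {ρ ρ′ : Fin v → ℕ} → Tracks f ρ ρ′ → Tracks (↔-sym f) ρ′ ρ
Tracks-sym f t x = sym (trans (cong (Inverse.from f) (t x)) (from∘to f _))

Tracks-extend : ∀ {v len} f {ρ ρ′ : Fin v → ℕ} (ys ys′ : Vec ℕ len) → Tracks f ρ ρ′ →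
  (∀ i → lookup ys′ i ≡ Inverse.to f (lookup ys i)) → Tracks f (extend ρ ys) (extend ρ′ ys′)
Tracks-extend {v} f ys ys′ t u x with splitAt v x
... | inj₁ p = t p
... | inj₂ q = u q

Tracks-map-to : ∀ {v len} f {ρ ρ′ : Fin v → ℕ} (ys : Vec ℕ len) → Tracks f ρ ρ′ →
  Tracks f (extend ρ ys) (extend ρ′ (Vec.map (Inverse.to f) ys))
Tracks-map-to f ys t = Tracks-extend f ys (Vec.map (Inverse.to f) ys) t (λ i → VecP.lookup-map i (Inverse.to f) ys)

Tracks-map-from : ∀ {v len} f {ρ ρ′ : Fin v → ℕ} (ys : Vec ℕ len) → Tracks f ρ ρ′ →
  Tracks f (extend ρ (Vec.map (Inverse.from f) ys)) (extend ρ′ ys)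
Tracks-map-from f ys t = Tracks-extend f (Vec.map (Inverse.from f) ys) ys t (λ i →
  trans (sym (to∘from f _)) (cong (Inverse.to f) (sym (VecP.lookup-map i (Inverse.from f) ys))))

module _ {L : Sig} where

  SatQF-≅ : ∀ {v} {A B : Str L} (iso : A ≅ B) (φ : QF L v) {ρ ρ′ : Fin v → ℕ} →
    Tracks (proj₁ iso) ρ ρ′ → SatQF A φ ρ → SatQF B φ ρ′
  SatQF-≅ {A = A} {B} (f , h) (rel j xs) {ρ} {ρ′} t a = begin
    B j (Vec.map ρ′ xs)                         ≡⟨ cong (B j) (VecP.map-cong t xs) ⟩
    B j (Vec.map (λ x → Inverse.to f (ρ x)) xs) ≡⟨ cong (B j) (VecP.map-∘ _ ρ xs) ⟩
    B j (Vec.map (Inverse.to f) (Vec.map ρ xs)) ≡⟨ h j _ ⟨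
    A j (Vec.map ρ xs)                          ≡⟨ a ⟩
    true ∎
    where open ≡-Reasoning
  SatQF-≅ (f , _) (eq x y) t a = trans (t x) (trans (cong (Inverse.to f) a) (sym (t y)))
  SatQF-≅ iso (neg φ) t ¬a b = ¬a (SatQF-≅ (≅-sym iso) φ (Tracks-sym (proj₁ iso) t) b)
  SatQF-≅ iso (and φ ψ) t (a , b) = SatQF-≅ iso φ t a , SatQF-≅ iso ψ t b
  SatQF-≅ iso (or φ ψ) t (inj₁ a) = inj₁ (SatQF-≅ iso φ t a)
  SatQF-≅ iso (or φ ψ) t (inj₂ b) = inj₂ (SatQF-≅ iso ψ t b)

  module _ {A B : Str L} (iso : A ≅ B) where
    private f = proj₁ iso

    mutual
      SatΣ-≅ : ∀ {n v} (φ : SigmaF L n v) {ρ ρ′} → Tracks f ρ ρ′ → SatΣ A φ ρ → SatΣ B φ ρ′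
      SatΣ-≅ (qfΣ φ) t a = SatQF-≅ iso φ t a
      SatΣ-≅ (⋁∃ ds) t (i , a) = i , SatD-≅ (ds i) t a

      SatD-≅ : ∀ {n v} (d : Maybe (Disjunct L n v)) {ρ ρ′} → Tracks f ρ ρ′ → SatD A d ρ → SatD B d ρ′
      SatD-≅ (just (∃[ _ , _ , _ ] ξ)) t (ys , a) =
        Vec.map (Inverse.to f) ys , SatΠ-≅ ξ (Tracks-map-to f ys t) a

      SatΠ-≅ : ∀ {n v} (φ : PiF L n v) {ρ ρ′} → Tracks f ρ ρ′ → SatΠ A φ ρ → SatΠ B φ ρ′
      SatΠ-≅ (qfΠ φ) t a = SatQF-≅ iso φ t a
      SatΠ-≅ (⋀∀ cs) t a i = SatC-≅ (cs i) t (a i)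

      SatC-≅ : ∀ {n v} (c : Maybe (Conjunct L n v)) {ρ ρ′} → Tracks f ρ ρ′ → SatC A c ρ → SatC B c ρ′
      SatC-≅ nothing t a = tt
      SatC-≅ (just (∀[ _ , _ , _ ] ξ)) t a ys =
        SatΣ-≅ ξ (Tracks-map-from f ys t) (a (Vec.map (Inverse.from f) ys))

    ⊨-≅ : (ψ : Σ2Sentence L) → A ⊨ ψ → B ⊨ ψ
    ⊨-≅ ψ = SatΣ-≅ ψ {noVars} {noVars} (λ ())

-- Coding tuples; countable types

next : ℕ × ℕ → ℕ × ℕ
next (a , zero)  = zero , suc a
next (a , suc b) = suc a , b

unpair : ℕ → ℕ × ℕ
unpair zero    = 0 , 0
unpair (suc n) = next (unpair n)

unpair-surjective : ∀ a b → Σ ℕ λ n → unpair n ≡ (a , b)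
unpair-surjective a b = go (a + b) a b refl
  where
  go : ∀ t a b → a + b ≡ t → Σ ℕ λ n → unpair n ≡ (a , b)
  go t       (suc a) b       e = let n , p = go t a (suc b) (trans (+-suc a b) e) in suc n , cong next p
  go zero    zero    zero    _ = 0 , refl
  go (suc t) zero    (suc b) e = let n , p = go t b 0 (trans (+-identityʳ b) (suc-injective e)) in
                                 suc n , cong next p

unpair-≤ : ∀ n → proj₁ (unpair n) ≤ n × proj₂ (unpair n) ≤ n
unpair-≤ zero    = z≤n , z≤n
unpair-≤ (suc n) = next-≤ (unpair n) (unpair-≤ n)
  where
  next-≤ : ∀ p → proj₁ p ≤ n × proj₂ p ≤ n → proj₁ (next p) ≤ suc n × proj₂ (next p) ≤ suc n
  next-≤ (a , zero)  (a≤n , _)   = z≤n , s≤s a≤n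
  next-≤ (a , suc b) (a≤n , b<n) = s≤s a≤n , m≤n⇒m≤1+n (<⇒≤ b<n)

decodeTuple : ∀ l → ℕ → Vec ℕ l
decodeTuple zero    n = []
decodeTuple (suc l) n = proj₁ (unpair n) ∷ decodeTuple l (proj₂ (unpair n))

decodeTuple-surjective : ∀ {l} (a : Vec ℕ l) → Σ ℕ λ n → decodeTuple l n ≡ a
decodeTuple-surjective []      = 0 , refl
decodeTuple-surjective (x ∷ a) =
  let m , em = decodeTuple-surjective a ; n , en = unpair-surjective x m in
  n , cong₂ _∷_ (cong proj₁ en) (trans (cong (decodeTuple _ ∘ proj₂) en) em)

decodeTuple-≤ : ∀ l {n b} → n ≤ b → VAll.All (_≤ b) (decodeTuple l n)
decodeTuple-≤ zero    n≤b = VAll.[]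
decodeTuple-≤ (suc l) {n} n≤b =
  ≤-trans (proj₁ (unpair-≤ n)) n≤b VAll.∷ decodeTuple-≤ l (≤-trans (proj₂ (unpair-≤ n)) n≤b)

record Countable (X : Set) : Set where
  field
    decode            : ℕ → Maybe X
    decode-surjective : ∀ x → Σ ℕ λ n → decode n ≡ just x
open Countable

ℕ-countable : Countable ℕ
ℕ-countable = record { decode = just ; decode-surjective = λ x → x , refl }

Bool-countable : Countable Bool
Bool-countable = record { decode = decodeBool ; decode-surjective = λ { false → 0 , refl ; true → 1 , refl } }
  where
  decodeBool : ℕ → Maybe Bool
  decodeBool zero    = just false
  decodeBool (suc _) = just true

Fin-countable : ∀ V → Countable (Fin V)
Fin-countable V = record { decode = λ n → decodeFin (n <? V) ; decode-surjective = surj }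
  where
  decodeFin : ∀ {n} → Dec (n < V) → Maybe (Fin V)
  decodeFin (yes n<V) = just (fromℕ< n<V)
  decodeFin (no _)    = nothing
  decodeFin-toℕ : ∀ x (d : Dec (toℕ x < V)) → decodeFin d ≡ just x
  decodeFin-toℕ x (yes x<V) = cong just (FinP.fromℕ<-toℕ x x<V)
  decodeFin-toℕ x (no x≮V)  = ⊥-elim (x≮V (FinP.toℕ<n x))
  surj : ∀ x → Σ ℕ λ n → decodeFin (n <? V) ≡ just x
  surj x = toℕ x , decodeFin-toℕ x (toℕ x <? V)

Σ-countable : ∀ {A : Set} {B : A → Set} → Countable A → (∀ a → Countable (B a)) → Countable (Σ A B)
Σ-countable {A} {B} CA CB = record { decode = decodeΣ ∘ unpair ; decode-surjective = surj }
  where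
  decodeFiber : Maybe A → ℕ → Maybe (Σ A B)
  decodeFiber nothing  q = nothing
  decodeFiber (just a) q = Maybe.map (a ,_) (decode (CB a) q)
  decodeΣ : ℕ × ℕ → Maybe (Σ A B)
  decodeΣ (p , q) = decodeFiber (decode CA p) q
  surj : ∀ x → Σ ℕ λ n → decodeΣ (unpair n) ≡ just x
  surj (a , b) =
    let p , ep = decode-surjective CA a ; q , eq′ = decode-surjective (CB a) b ; n , en = unpair-surjective p q in
    n , trans (cong decodeΣ en) (trans (cong (λ m → decodeFiber m q) ep) (cong (Maybe.map (a ,_)) eq′))

×-countable : ∀ {A B : Set} → Countable A → Countable B → Countable (A × B)
×-countable CA CB = Σ-countable CA (λ _ → CB)

Vec-countable : ∀ {X : Set} → Countable X → ∀ l → Countable (Vec X l)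
Vec-countable CX zero    = record { decode = λ _ → just [] ; decode-surjective = λ { [] → 0 , refl } }
Vec-countable CX (suc l) = record
  { decode            = Maybe.map (uncurry _∷_) ∘ decode C
  ; decode-surjective = λ { (x ∷ xs) → let n , e = decode-surjective C (x , xs) in
                                       n , cong (Maybe.map (uncurry _∷_)) e }
  }
  where C = ×-countable CX (Vec-countable CX l)

List-countable : ∀ {X : Set} → Countable X → Countable (List X)
List-countable CX = record
  { decode            = Maybe.map (Vec.toList ∘ proj₂) ∘ decode C
  ; decode-surjective = λ xs → let n , e = decode-surjective C (length xs , Vec.fromList xs) in
      n , trans (cong (Maybe.map (Vec.toList ∘ proj₂)) e) (cong just (VecP.toList∘fromList xs))
  }
  where C = Σ-countable ℕ-countable (Vec-countable CX)

¬∀⇒∃¬ : LEM → ∀ {A : Set} {P : A → Set} → ¬ (∀ x → P x) → Σ A λ x → ¬ P x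
¬∀⇒∃¬ lem {A} {P} ¬∀ with lem (Σ A λ x → ¬ P x)
... | yes ∃¬ = ∃¬
... | no ¬∃¬ = ⊥-elim (¬∀ λ x → decidable-stable (lem (P x)) (λ ¬Px → ¬∃¬ (x , ¬Px)))

Least : (ℕ → Set) → ℕ → Set
Least P c = P c × (∀ c′ → c′ < c → ¬ P c′)

least : LEM → (P : ℕ → Set) → ∀ n → P n → Σ ℕ (Least P)
least lem P n = go n (<-wellFounded n)
  where
  go : ∀ n → Acc _<_ n → P n → Σ ℕ (Least P)
  go n (acc below) Pn with lem (Σ ℕ λ c → c < n × P c)
  ... | yes (c , c<n , Pc) = go c (below c<n) Pc
  ... | no ¬smaller        = n , Pn , λ c c<n Pc → ¬smaller (c , c<n , Pc)

Least-unique : ∀ {P a b} → Least P a → Least P b → a ≡ b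
Least-unique {a = a} {b} (Pa , minA) (Pb , minB) with <-cmp a b
... | tri< a<b _ _ = ⊥-elim (minB a a<b Pa)
... | tri≈ _ a≡b _ = a≡b
... | tri> _ _ b<a = ⊥-elim (minA b b<a Pb)

-- Lists as finite assignments

nth : ∀ {A : Set} → A → List A → ℕ → A
nth d []      _       = d
nth d (a ∷ l) zero    = a
nth d (a ∷ l) (suc x) = nth d l x

module _ {A : Set} (d : A) where

  nth-++ˡ : ∀ l m {x} → x < length l → nth d (l ++ m) x ≡ nth d l x
  nth-++ˡ (a ∷ l) m {zero}  _       = refl
  nth-++ˡ (a ∷ l) m {suc x} (s≤s h) = nth-++ˡ l m h

  nth-++ʳ : ∀ l m x → nth d (l ++ m) (length l + x) ≡ nth d m x
  nth-++ʳ []      m x = refl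
  nth-++ʳ (a ∷ l) m x = nth-++ʳ l m x

  nth-length-++ : ∀ l a m → nth d (l ++ a ∷ m) (length l) ≡ a
  nth-length-++ l a m = trans (cong (nth d (l ++ a ∷ m)) (sym (+-identityʳ (length l)))) (nth-++ʳ l (a ∷ m) 0)

  nth-All : ∀ {P : A → Set} l {x} → All P l → x < length l → P (nth d l x)
  nth-All (a ∷ l) {zero}  (p ∷ _)  _       = p
  nth-All (a ∷ l) {suc x} (_ ∷ ps) (s≤s h) = nth-All l ps h

  nth-toList : ∀ {n} (ys : Vec A n) q → nth d (Vec.toList ys) (toℕ q) ≡ lookup ys q
  nth-toList (y ∷ ys) Fin.zero    = refl
  nth-toList (y ∷ ys) (Fin.suc q) = nth-toList ys q

infixl 20 _!_
_!_ : List ℕ → ℕ → ℕ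
l ! x = nth 0 l x

length<length-++-∷ : ∀ {A : Set} (xs : List A) y ys → length xs < length (xs ++ y ∷ ys)
length<length-++-∷ []       y ys = z<s
length<length-++-∷ (x ∷ xs) y ys = s<s (length<length-++-∷ xs y ys)

module _ {A B : Set} {P : B → Set} (f : A → List B) where

  All-concatMap⁺ : ∀ xs → All (λ x → All P (f x)) xs → All P (concatMap f xs)
  All-concatMap⁺ xs = AllP.concat⁺ ∘ AllP.map⁺

  All-concatMap⁻ : ∀ xs → All P (concatMap f xs) → All (λ x → All P (f x)) xs
  All-concatMap⁻ xs = AllP.map⁻ ∘ AllP.concat⁻

take-++ : ∀ {A : Set} (xs ys : List A) k → take (length xs + k) (xs ++ ys) ≡ xs ++ take k ys
take-++ []       ys k = refl
take-++ (x ∷ xs) ys k = cong (x ∷_) (take-++ xs ys k)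

take-length-++ : ∀ {A : Set} (xs ys : List A) → take (length xs) (xs ++ ys) ≡ xs
take-length-++ xs ys = begin
  take (length xs) (xs ++ ys)     ≡⟨ cong (λ n → take n (xs ++ ys)) (+-identityʳ (length xs)) ⟨
  take (length xs + 0) (xs ++ ys) ≡⟨ take-++ xs ys 0 ⟩
  xs ++ []                        ≡⟨ ListP.++-identityʳ xs ⟩
  xs ∎
  where open ≡-Reasoning

module _ {A : Set} where

  infix 4 _≼_
  _≼_ : List A → List A → Set
  xs ≼ ys = Σ (List A) λ zs → ys ≡ xs ++ zs

  ≼-refl : ∀ xs → xs ≼ xs
  ≼-refl xs = [] , sym (ListP.++-identityʳ xs)

  ≼-++ : ∀ xs ys → xs ≼ xs ++ ys
  ≼-++ xs ys = ys , refl

  ≼-trans : ∀ {xs ys zs} → xs ≼ ys → ys ≼ zs → xs ≼ zs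
  ≼-trans {xs} (us , refl) (vs , refl) = us ++ vs , ListP.++-assoc xs us vs

  ≼-length : ∀ {xs ys} → xs ≼ ys → length xs ≤ length ys
  ≼-length {xs} (zs , refl) = ListP.length-++-≤ˡ xs

  nth-≼ : ∀ d {xs ys x} → xs ≼ ys → x < length xs → nth d ys x ≡ nth d xs x
  nth-≼ d {xs} (zs , refl) = nth-++ˡ d xs zs

applyUpTo-nth : ∀ {A : Set} (d : A) (f : ℕ → A) l s → (∀ {x} → x < s → f x ≡ nth d l x) →
  s ≤ length l → applyUpTo f s ≡ take s l
applyUpTo-nth d f l       zero    _  _         = refl
applyUpTo-nth d f (a ∷ l) (suc s) f≡ (s≤s s≤n) =
  cong₂ _∷_ (f≡ z<s) (applyUpTo-nth d (f ∘ suc) l s (f≡ ∘ s<s) s≤n)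

module Limit {A : Set} (d : A) (ls : ℕ → List A) (grows : ∀ {n m} → n ≤ m → ls n ≼ ls m)
  (long : ∀ n → n ≤ length (ls n)) where

  lim : ℕ → A
  lim x = nth d (ls (suc x)) x

  lim-stable : ∀ n {x} → x < length (ls n) → nth d (ls n) x ≡ lim x
  lim-stable n {x} x<n =
    trans (sym (nth-≼ d (grows (m≤m⊔n n (suc x))) x<n)) (nth-≼ d (grows (m≤n⊔m n (suc x))) (long (suc x)))

  lim-prefix : ∀ n {s} → s ≤ length (ls n) → applyUpTo lim s ≡ take s (ls n)
  lim-prefix n s≤ = applyUpTo-nth d lim (ls n) _ (λ x<s → sym (lim-stable n (≤-trans x<s s≤))) s≤

Distinct : List ℕ → Set
Distinct l = ∀ x y → x < length l → y < length l → l ! x ≡ l ! y → x ≡ y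

Distinct-[] : Distinct []
Distinct-[] _ _ ()

Occurs : ℕ → List ℕ → Set
Occurs v l = Σ ℕ λ p → p < length l × l ! p ≡ v

Occurs-≼ : ∀ {v l l′} → l ≼ l′ → Occurs v l → Occurs v l′
Occurs-≼ l≼l′ (p , p<n , lp≡v) = p , ≤-trans p<n (≼-length l≼l′) , trans (nth-≼ 0 l≼l′ p<n) lp≡v

Distinct-∷ʳ : ∀ {l v} → Distinct l → ¬ Occurs v l → Distinct (l ++ v ∷ [])
Distinct-∷ʳ {l} {v} distinct fresh x y x<1+n y<1+n lx≡ly
  with <-cmp x (length l) | <-cmp y (length l)
... | tri< x<n _ _ | tri< y<n _ _ =
  distinct x y x<n y<n (trans (sym (nth-++ˡ 0 l _ x<n)) (trans lx≡ly (nth-++ˡ 0 l _ y<n)))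
... | tri< x<n _ _ | tri≈ _ refl _ =
  ⊥-elim (fresh (x , x<n , trans (sym (nth-++ˡ 0 l _ x<n)) (trans lx≡ly (nth-length-++ 0 l v []))))
... | tri≈ _ refl _ | tri< y<n _ _ =
  ⊥-elim (fresh (y , y<n , trans (sym (nth-++ˡ 0 l _ y<n)) (trans (sym lx≡ly) (nth-length-++ 0 l v []))))
... | tri≈ _ refl _ | tri≈ _ refl _ = refl
... | tri> _ _ n<x | _ = ⊥-elim (<⇒≱ x<1+n (subst (_≤ x) (sym (ListP.length-++-comm l (v ∷ []))) n<x))
... | _ | tri> _ _ n<y = ⊥-elim (<⇒≱ y<1+n (subst (_≤ y) (sym (ListP.length-++-comm l (v ∷ []))) n<y))

sum : List ℕ → ℕ
sum = Data.List.foldr _+_ 0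

suc-sum-fresh : ∀ l → ¬ Occurs (suc (sum l)) l
suc-sum-fresh l (p , _ , lp≡) = <-irrefl lp≡ (s≤s (nth≤sum l p))
  where
  nth≤sum : ∀ l p → l ! p ≤ sum l
  nth≤sum []      p       = z≤n
  nth≤sum (a ∷ l) zero    = m≤m+n a _
  nth≤sum (a ∷ l) (suc p) = ≤-trans (nth≤sum l p) (m≤n+m _ a)

record Assigns {V} (l : List ℕ) (w : Fin V → ℕ) : Set where
  constructor assigns
  field
    length≡ : length l ≡ V
    value≡  : ∀ x → w x ≡ l ! toℕ x

Assigns-noVars : Assigns [] noVars
Assigns-noVars = assigns refl λ ()

Assigns-extend : ∀ {v len} {ρ : Fin v → ℕ} {l} (ys : Vec ℕ len) → Assigns l ρ →
  Assigns (l ++ Vec.toList ys) (extend ρ ys)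
Assigns-extend {v} {len} {ρ} {l} ys (assigns refl ρ≡) =
  assigns (trans (ListP.length-++ l) (cong (length l +_) (VecP.length-toList ys))) value
  where
  value : ∀ x → extend ρ ys x ≡ (l ++ Vec.toList ys) ! toℕ x
  value x with splitAt v x in split
  ... | inj₁ p = begin
    ρ p                          ≡⟨ ρ≡ p ⟩
    l ! toℕ p                    ≡⟨ nth-++ˡ 0 l _ (FinP.toℕ<n p) ⟨
    (l ++ _) ! toℕ p             ≡⟨ cong ((l ++ _) !_) (FinP.toℕ-↑ˡ p len) ⟨
    (l ++ _) ! toℕ (p Fin.↑ˡ len) ≡⟨ cong (λ y → (l ++ _) ! toℕ y) (FinP.splitAt⁻¹-↑ˡ split) ⟩
    (l ++ _) ! toℕ x ∎
    where open ≡-Reasoning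
  ... | inj₂ q = begin
    lookup ys q                        ≡⟨ nth-toList 0 ys q ⟨
    Vec.toList ys ! toℕ q              ≡⟨ nth-++ʳ 0 l _ (toℕ q) ⟨
    (l ++ _) ! (length l + toℕ q)      ≡⟨ cong ((l ++ _) !_) (FinP.toℕ-↑ʳ (length l) q) ⟨
    (l ++ _) ! toℕ (length l Fin.↑ʳ q) ≡⟨ cong (λ y → (l ++ _) ! toℕ y) (FinP.splitAt⁻¹-↑ʳ split) ⟩
    (l ++ _) ! toℕ x ∎
    where open ≡-Reasoning

Assigns-cast : ∀ {V} {l l′} {w : Fin V → ℕ} → l ≡ l′ → Assigns l w → Assigns l′ w
Assigns-cast refl a = a

Separates : ∀ {V} → (Fin V → ℕ) → Set
Separates w = ∀ {p q} → p ≢ q → w p ≢ w q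

Distinct⇒Separates : ∀ {V} {l} {w : Fin V → ℕ} → Assigns l w → Distinct l → Separates w
Distinct⇒Separates (assigns refl w≡) distinct {p} {q} p≢q wp≡wq = p≢q (FinP.toℕ-injective
  (distinct _ _ (FinP.toℕ<n p) (FinP.toℕ<n q) (trans (sym (w≡ p)) (trans wp≡wq (w≡ q)))))

Separates⇒Distinct : ∀ {V} {l} {w : Fin V → ℕ} → Assigns l w → Separates w → Distinct l
Separates⇒Distinct {l = l} {w} (assigns refl w≡) separates x y x<n y<n lx≡ly with x ≟ y
... | yes x≡y = x≡y
... | no x≢y  = ⊥-elim (separates p≢q (begin
  w (fromℕ< x<n)          ≡⟨ w≡ _ ⟩
  l ! toℕ (fromℕ< x<n)    ≡⟨ cong (l !_) (FinP.toℕ-fromℕ< x<n) ⟩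
  l ! x                   ≡⟨ lx≡ly ⟩
  l ! y                   ≡⟨ cong (l !_) (FinP.toℕ-fromℕ< y<n) ⟨
  l ! toℕ (fromℕ< y<n)    ≡⟨ w≡ _ ⟨
  w (fromℕ< y<n) ∎))
  where
  open ≡-Reasoning
  p≢q : fromℕ< x<n ≢ fromℕ< y<n
  p≢q p≡q = x≢y (trans (sym (FinP.toℕ-fromℕ< x<n)) (trans (cong toℕ p≡q) (FinP.toℕ-fromℕ< y<n)))

map-cong-below : ∀ {n b} {g h : ℕ → ℕ} → (∀ {x} → x < b → g x ≡ h x) → (a : Vec ℕ n) →
  VAll.All (_< b) a → Vec.map g a ≡ Vec.map h a
map-cong-below g≡h []      VAll.[]          = refl
map-cong-below g≡h (x ∷ a) (x<b VAll.∷ a<b) = cong₂ _∷_ (g≡h x<b) (map-cong-below g≡h a a<b)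

toFinVec : ∀ V {n} → Vec ℕ n → Maybe (Vec (Fin V) n)
toFinVec V []      = just []
toFinVec V (x ∷ a) with x <? V | toFinVec V a
... | yes x<V | just xs = just (fromℕ< x<V ∷ xs)
... | _       | _       = nothing

toFinVec-sound : ∀ V {n} (a : Vec ℕ n) {xs} → toFinVec V a ≡ just xs → Vec.map toℕ xs ≡ a
toFinVec-sound V []      refl = refl
toFinVec-sound V (x ∷ a) e with x <? V | toFinVec V a in e′
toFinVec-sound V (x ∷ a) refl | yes x<V | just xs = cong₂ _∷_ (FinP.toℕ-fromℕ< x<V) (toFinVec-sound V a e′)

toFinVec-complete : ∀ V {n} (a : Vec ℕ n) → VAll.All (_< V) a →
  Σ (Vec (Fin V) n) λ xs → toFinVec V a ≡ just xs
toFinVec-complete V []      VAll.[]          = [] , refl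
toFinVec-complete V (x ∷ a) (x<V VAll.∷ a<V) with x <? V | toFinVec V a | toFinVec-complete V a a<V
... | yes x<V′ | just xs | _ , refl = fromℕ< x<V′ ∷ xs , refl
... | no x≮V   | _       | _        = ⊥-elim (x≮V x<V)

-- What a finite part of an informant forces

RowHolds : ∀ {L} → Str L → Row L → Set
RowHolds S r = ∀ j → S j (proj₁ (r j)) ≡ proj₂ (r j)

AgreesWith : ∀ {L} → Str L → Informant L → ℕ → Set
AgreesWith S I s = ∀ m → m < s → RowHolds S (I m)

AgreesWith⇒All : ∀ {L} {S : Str L} I s → AgreesWith S I s → All (RowHolds S) (I [ s ])
AgreesWith⇒All I s agree = AllP.map⁺ (AllP.applyUpTo⁺₁ (λ x → x) s (agree _))

All⇒AgreesWith : ∀ {L} {S : Str L} I s → All (RowHolds S) (I [ s ]) → AgreesWith S I s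
All⇒AgreesWith I s all m = AllP.applyUpTo⁻ (λ x → x) s (AllP.map⁻ all)

length-prefix : ∀ {L} (I : Informant L) s → length (I [ s ]) ≡ s
length-prefix I s = trans (ListP.length-map I (upTo s)) (ListP.length-applyUpTo (λ x → x) s)

module Forcing (lem : LEM) {L : Sig} {A : Str L} {I : Informant L} (I-informs : IsInformantFor I A) where

  agrees : ∀ s → AgreesWith A I s
  agrees s m _ j = Equivalence.to (I-informs j _ _) (m , refl)

  Forced : (Str L → Set) → Set
  Forced G = Σ ℕ λ s → ∀ S → AgreesWith S I s → G S

  forced-map : ∀ {G H : Str L → Set} → (∀ {S} → G S → H S) → Forced G → Forced H
  forced-map f (s , forces) = s , λ S agree → f (forces S agree)

  forced-× : ∀ {G H : Str L → Set} → Forced G → Forced H → Forced (λ S → G S × H S)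
  forced-× (s , fG) (t , fH) = s ⊔ t , λ S agree →
    fG S (λ m m<s → agree m (≤-trans m<s (m≤m⊔n s t))) ,
    fH S (λ m m<t → agree m (≤-trans m<t (m≤n⊔m s t)))

  forced-below : ∀ n {G : ℕ → Str L → Set} → (∀ c → c < n → Forced (G c)) →
    Forced (λ S → ∀ c → c < n → G c S)
  forced-below zero    _      = 0 , λ _ _ _ ()
  forced-below (suc n) {G} forced =
    forced-map extend-below (forced-× (forced-below n (λ c c<n → forced c (m<n⇒m<1+n c<n))) (forced n ≤-refl))
    where
    extend-below : ∀ {S} → (∀ c → c < n → G c S) × G n S → ∀ c → c < suc n → G c S
    extend-below (below , at) c c<1+n with m≤n⇒m<n∨m≡n (s≤s⁻¹ c<1+n)
    ... | inj₁ c<n  = below c c<n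
    ... | inj₂ refl = at

  SatQF-forced : ∀ {v} (φ : QF L v) (ρ : Fin v → ℕ) → Forced (λ S → SatQF S φ ρ ⇔ SatQF A φ ρ)
  SatQF-forced (rel j xs) ρ =
    let m , Im≡ = Equivalence.from (I-informs j (Vec.map ρ xs) _) refl in
    suc m , λ S agree → let S≡A = subst (λ r → S j (proj₁ r) ≡ proj₂ r) Im≡ (agree m ≤-refl j) in
      mk⇔ (trans (sym S≡A)) (trans S≡A)
  SatQF-forced (eq x y)  ρ = 0 , λ _ _ → ⇔.refl
  SatQF-forced (neg φ)   ρ = forced-map ¬-cong-⇔ (SatQF-forced φ ρ)
  SatQF-forced (and φ ψ) ρ = forced-map (uncurry _×-⇔_) (forced-× (SatQF-forced φ ρ) (SatQF-forced ψ ρ))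
  SatQF-forced (or φ ψ)  ρ = forced-map (uncurry _⊎-⇔_) (forced-× (SatQF-forced φ ρ) (SatQF-forced ψ ρ))

  ¬SatC-forced : ∀ {v} (c : Maybe (Conjunct L 0 v)) (ρ : Fin v → ℕ) →
    ¬ SatC A c ρ → Forced (λ S → ¬ SatC S c ρ)
  ¬SatC-forced nothing ρ ¬Ac = ⊥-elim (¬Ac tt)
  ¬SatC-forced (just (∀[ _ , _ , z≤n ] qfΣ φ)) ρ ¬Ac =
    let zs , ¬Aφ = ¬∀⇒∃¬ lem ¬Ac in
    forced-map (λ φ⇔ Sc → ¬Aφ (Equivalence.to φ⇔ (Sc zs))) (SatQF-forced φ (extend ρ zs))

  ¬SatΠ₁-forced : ∀ {m v} → m ≤ 1 → (ξ : PiF L m v) (ρ : Fin v → ℕ) →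
    ¬ SatΠ A ξ ρ → Forced (λ S → ¬ SatΠ S ξ ρ)
  ¬SatΠ₁-forced _ (qfΠ φ) ρ ¬Aφ =
    forced-map (λ φ⇔ Sφ → ¬Aφ (Equivalence.to φ⇔ Sφ)) (SatQF-forced φ ρ)
  ¬SatΠ₁-forced (s≤s z≤n) (⋀∀ cs) ρ ¬Aξ =
    let i , ¬Ac = ¬∀⇒∃¬ lem ¬Aξ in
    forced-map (λ ¬Sc Sξ → ¬Sc (Sξ i)) (¬SatC-forced (cs i) ρ ¬Ac)

-- (2) ⇒ (1): a learner from the sentences

module LearnerFromSentences (lem : LEM) {L : Sig} (ν : ℕ → Str L) (B : ℕ → Str L)
  (index : ℕ → ℕ) (index-correct : ∀ i → ν (index i) ≅ B i)
  (ψ : ℕ → Σ2Sentence L) (ψ-characterises : ∀ i j → (B j ⊨ ψ i) ⇔ (i ≡ j)) where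

  disjuncts : Σ2Sentence L → ℕ → Maybe (Disjunct L 1 0)
  disjuncts (⋁∃ ds) = ds

  WitnessedBy : Str L → Maybe (Disjunct L 1 0) → ℕ → Set
  WitnessedBy S nothing                       r = ⊥
  WitnessedBy S (just (∃[ len , _ , _ ] ξ)) r = SatΠ S ξ (extend noVars (decodeTuple len r))

  -- A candidate (i , d , r) claims that the tuple coded by r witnesses the d-th disjunct of ψ i.
  candidate : ℕ → ℕ × ℕ × ℕ
  candidate c = proj₁ (unpair c) , unpair (proj₂ (unpair c))

  candidate-surjective : ∀ i d r → Σ ℕ λ c → candidate c ≡ (i , d , r)
  candidate-surjective i d r =
    let c′ , c′≡ = unpair-surjective d r ; c , c≡ = unpair-surjective i c′ in
    c , cong₂ _,_ (cong proj₁ c≡) (trans (cong (unpair ∘ proj₂) c≡) c′≡)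

  Holds : Str L → ℕ × ℕ × ℕ → Set
  Holds S (i , d , r) = WitnessedBy S (disjuncts (ψ i) d) r

  Good : Str L → ℕ → Set
  Good S c = Holds S (candidate c)

  WitnessedBy⇒SatD : ∀ {S} δ r → WitnessedBy S δ r → SatD S δ noVars
  WitnessedBy⇒SatD (just (∃[ len , _ , _ ] _)) r w = decodeTuple len r , w

  SatD⇒WitnessedBy : ∀ {S} δ → SatD S δ noVars → Σ ℕ (WitnessedBy S δ)
  SatD⇒WitnessedBy {S} (just (∃[ len , _ , _ ] ξ)) (ys , Sξ) =
    let r , r≡ = decodeTuple-surjective ys in r , subst (λ ys → SatΠ S ξ (extend noVars ys)) (sym r≡) Sξ

  WitnessedBy⇒⊨ : ∀ {S} φ d r → WitnessedBy S (disjuncts φ d) r → S ⊨ φ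
  WitnessedBy⇒⊨ (⋁∃ ds) d r w = d , WitnessedBy⇒SatD (ds d) r w

  ⊨⇒WitnessedBy : ∀ {S} φ → S ⊨ φ → Σ ℕ λ d → Σ ℕ (WitnessedBy S (disjuncts φ d))
  ⊨⇒WitnessedBy (⋁∃ ds) (d , sat) = d , SatD⇒WitnessedBy (ds d) sat

  Holds⇒⊨ : ∀ {S} t → Holds S t → S ⊨ ψ (proj₁ t)
  Holds⇒⊨ (i , d , r) = WitnessedBy⇒⊨ (ψ i) d r

  ⊨⇒Good : ∀ {S} i → S ⊨ ψ i → Σ ℕ (Good S)
  ⊨⇒Good {S} i sat =
    let d , r , w = ⊨⇒WitnessedBy (ψ i) sat ; c , c≡ = candidate-surjective i d r in
    c , subst (Holds S) (sym c≡) w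

  module _ {A : Str L} {I : Informant L} (I-informs : IsInformantFor I A) where
    open Forcing lem I-informs

    ¬WitnessedBy-forced : ∀ δ r → ¬ WitnessedBy A δ r → Forced (λ S → ¬ WitnessedBy S δ r)
    ¬WitnessedBy-forced nothing                         r _  = 0 , λ _ _ ()
    ¬WitnessedBy-forced (just (∃[ len , _ , m≤1 ] ξ)) r ¬w = ¬SatΠ₁-forced m≤1 ξ _ ¬w

    ¬Holds-forced : ∀ t → ¬ Holds A t → Forced (λ S → ¬ Holds S t)
    ¬Holds-forced (i , d , r) = ¬WitnessedBy-forced (disjuncts (ψ i) d) r

    ¬Good-forced : ∀ c → ¬ Good A c → Forced (λ S → ¬ Good S c)
    ¬Good-forced c = ¬Holds-forced (candidate c)

  Unrefuted : List (Row L) → ℕ → Set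
  Unrefuted σ c = ¬ (∀ S → All (RowHolds S) σ → ¬ Good S c)

  Chosen : List (Row L) → ℕ → Set
  Chosen σ c = c < length σ × Unrefuted σ c

  conjecture : ℕ → ℕ
  conjecture c = index (proj₁ (candidate c))

  learner : Learner L
  learner σ with lem (Σ ℕ (Chosen σ))
  ... | yes (c , chosen) = just (conjecture (proj₁ (least lem (Chosen σ) c chosen)))
  ... | no _             = nothing

  learner-least : ∀ σ c → Least (Chosen σ) c → learner σ ≡ just (conjecture c)
  learner-least σ c least-c with lem (Σ ℕ (Chosen σ))
  ... | yes (c′ , chosen) =
    cong (just ∘ conjecture) (Least-unique (proj₂ (least lem (Chosen σ) c′ chosen)) least-c)
  ... | no none           = ⊥-elim (none (c , proj₁ least-c))

  learns : (A : Str L) → GeneratedBy B A → (I : Informant L) → IsInformantFor I A →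
    Σ ℕ λ e → Σ ℕ λ s₀ → (ν e ≅ A) × ((s : ℕ) → s₀ ≤ s → learner (I [ s ]) ≡ just e)
  learns A (j , Bj≅A) I I-informs = index j , s₀ , ≅-trans {B = B j} {C = A} (index-correct j) Bj≅A , converges
    where
    open Forcing lem I-informs using (agrees; forced-below)

    A≅Bj : A ≅ B j
    A≅Bj = ≅-sym {A = B j} {B = A} Bj≅A

    first-good : Σ ℕ (Least (Good A))
    first-good = let c , good = ⊨⇒Good j (⊨-≅ Bj≅A (ψ j) (Equivalence.from (ψ-characterises j j) refl)) in
                 least lem (Good A) c good

    c* : ℕ
    c* = proj₁ first-good

    c*-good : Good A c*
    c*-good = proj₁ (proj₂ first-good)

    c*-names-j : proj₁ (candidate c*) ≡ j
    c*-names-j = Equivalence.to (ψ-characterises _ j)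
      (⊨-≅ A≅Bj (ψ (proj₁ (candidate c*))) (Holds⇒⊨ (candidate c*) c*-good))

    below-c*-refuted : Σ ℕ λ s → ∀ S → AgreesWith S I s → ∀ c → c < c* → ¬ Good S c
    below-c*-refuted = forced-below c* (λ c c<c* → ¬Good-forced I-informs c (proj₂ (proj₂ first-good) c c<c*))

    s₁ s₀ : ℕ
    s₁ = proj₁ below-c*-refuted
    s₀ = suc c* ⊔ s₁

    converges : ∀ s → s₀ ≤ s → learner (I [ s ]) ≡ just (index j)
    converges s s₀≤s = trans (learner-least (I [ s ]) c* (chosen , unchosen)) (cong (just ∘ index) c*-names-j)
      where
      chosen : Chosen (I [ s ]) c*
      chosen = subst (c* <_) (sym (length-prefix I s)) (≤-trans (m≤m⊔n (suc c*) s₁) s₀≤s) ,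
               λ refutes → refutes A (AgreesWith⇒All {S = A} I s (agrees s)) c*-good
      unchosen : ∀ c → c < c* → ¬ Chosen (I [ s ]) c
      unchosen c c<c* (_ , unrefuted) = unrefuted λ S S-agrees →
        proj₂ below-c*-refuted S (λ m m<s₁ → All⇒AgreesWith {S = S} I s S-agrees m (≤-trans m<s₁ s₁≤s)) c c<c*
        where s₁≤s = ≤-trans (m≤n⊔m (suc c*) s₁) s₀≤s

-- Finite diagrams

module Diagrams (L : Sig) where

  -- The tuples of the row are positions in ā, at which S satisfies the row.
  RowHoldsAt : Str L → List ℕ → Row L → Set
  RowHoldsAt S ā r = ∀ j →
    VAll.All (_< length ā) (proj₁ (r j)) × S j (Vec.map (ā !_) (proj₁ (r j))) ≡ proj₂ (r j)

  RowHoldsAt-++ : ∀ {S} ā z̄ {r} → RowHoldsAt S ā r → RowHoldsAt S (ā ++ z̄) r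
  RowHoldsAt-++ {S} ā z̄ holds j =
    VAll.map (λ x<n → ≤-trans x<n (ListP.length-++-≤ˡ ā)) (proj₁ (holds j)) ,
    trans (cong (S j) (map-cong-below (nth-++ˡ 0 ā z̄) _ (proj₁ (holds j)))) (proj₂ (holds j))

  AllRowHoldsAt-++ : ∀ {S} ā z̄ {τ} → All (RowHoldsAt S ā) τ → All (RowHoldsAt S (ā ++ z̄)) τ
  AllRowHoldsAt-++ {S} ā z̄ = All.map (RowHoldsAt-++ {S} ā z̄)

  -- An initial segment of an informant for the copy of S enumerated by elems; rows speak about positions.
  record Approximation (S : Str L) : Set where
    constructor approximation
    field
      rows     : List (Row L)
      elems    : List ℕ
      distinct : Distinct elems
      holds    : All (RowHoldsAt S elems) rows
  open Approximation public

  RowBelow : ℕ → Row L → Set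
  RowBelow V r = ∀ j → VAll.All (_< V) (proj₁ (r j))

  RowHoldsAt⇒RowBelow : ∀ {S ā V r} → length ā ≡ V → RowHoldsAt S ā r → RowBelow V r
  RowHoldsAt⇒RowBelow refl holds j = proj₁ (holds j)

  Literal : ℕ → Set
  Literal V = Σ (Sym L) λ j → Vec (Fin V) (Sig.ar L j) × Bool

  Literal-countable : ∀ V → Countable (Literal V)
  Literal-countable V =
    Σ-countable (Fin-countable _) (λ j → ×-countable (Vec-countable (Fin-countable V) (Sig.ar L j)) Bool-countable)

  literalQF : ∀ {V} → Literal V → QF L V
  literalQF (j , xs , true)  = rel j xs
  literalQF (j , xs , false) = neg (rel j xs)

  literalQF-sat : ∀ {V} {S : Str L} {w : Fin V → ℕ} j xs b →
    SatQF S (literalQF (j , xs , b)) w ⇔ (S j (Vec.map w xs) ≡ b)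
  literalQF-sat j xs true  = ⇔.refl
  literalQF-sat j xs false = mk⇔ BoolP.¬-not BoolP.not-¬

  SatLiterals : ∀ {V} → Str L → List (Literal V) → (Fin V → ℕ) → Set
  SatLiterals S D w = All (λ lt → SatQF S (literalQF lt) w) D

  rowLiteral : ∀ V (r : Row L) j → Maybe (Vec (Fin V) (Sig.ar L j)) → List (Literal V)
  rowLiteral V r j (just xs) = (j , xs , proj₂ (r j)) ∷ []
  rowLiteral V r j nothing   = []

  rowLiterals : ∀ V → Row L → List (Literal V)
  rowLiterals V r = concatMap (λ j → rowLiteral V r j (toFinVec V (proj₁ (r j)))) (allFin _)

  literals : ∀ V → List (Row L) → List (Literal V)
  literals V = concatMap (rowLiterals V)

  CoveredBy : ∀ V → List (Literal V) → Row L → Set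
  CoveredBy V D r = ∀ j → Σ (Vec (Fin V) (Sig.ar L j)) λ xs →
    Vec.map toℕ xs ≡ proj₁ (r j) × (j , xs , proj₂ (r j)) ∈ D

  literals-cover : ∀ V τ → All (RowBelow V) τ → All (CoveredBy V (literals V τ)) τ
  literals-cover V τ below = All.tabulate λ {r} r∈τ j →
    let xs , xs≡ = toFinVec-complete V (proj₁ (r j)) (All.lookup below r∈τ j) in
    xs , toFinVec-sound V _ xs≡ ,
    ∈-concat⁺′ (∈-concat⁺′ (subst (λ m → (j , xs , proj₂ (r j)) ∈ rowLiteral V r j m) (sym xs≡) (here refl))
                            (∈-map⁺ (λ j → rowLiteral V r j (toFinVec V (proj₁ (r j)))) (∈-allFin j)))
               (∈-map⁺ (rowLiterals V) r∈τ)

  module _ {V} {S : Str L} {l} {w : Fin V → ℕ} (l-assigns : Assigns l w) where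

    private
      map-w : ∀ {n} (xs : Vec (Fin V) n) → Vec.map w xs ≡ Vec.map (l !_) (Vec.map toℕ xs)
      map-w xs = trans (VecP.map-cong (Assigns.value≡ l-assigns) xs) (VecP.map-∘ _ toℕ xs)

    literals-hold : ∀ τ → All (RowHoldsAt S l) τ → SatLiterals S (literals V τ) w
    literals-hold τ holds = AllP.concat⁺ (AllP.map⁺ (All.map row-literals-hold holds))
      where
      entry-holds : ∀ {r} j → RowHoldsAt S l r → ∀ m → (∀ {xs} → m ≡ just xs → Vec.map toℕ xs ≡ proj₁ (r j)) →
        SatLiterals S (rowLiteral V r j m) w
      entry-holds j holds (just xs) sound = Equivalence.from (literalQF-sat j xs _)
        (trans (cong (S j) (trans (map-w xs) (cong (Vec.map (l !_)) (sound refl)))) (proj₂ (holds j))) ∷ []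
      entry-holds j holds nothing sound = []
      row-literals-hold : ∀ {r} → RowHoldsAt S l r → SatLiterals S (rowLiterals V r) w
      row-literals-hold {r} holds = AllP.concat⁺ (AllP.map⁺ (AllP.tabulate⁺ λ j →
        entry-holds j holds _ (toFinVec-sound V (proj₁ (r j)))))

    covered-holds : ∀ {D} τ → All (CoveredBy V D) τ → SatLiterals S D w → All (RowHoldsAt S l) τ
    covered-holds {D} τ covered sat = All.map row-holds covered
      where
      toℕ<-all : ∀ {n} (xs : Vec (Fin V) n) → VAll.All (_< length l) (Vec.map toℕ xs)
      toℕ<-all []       = VAll.[]
      toℕ<-all (x ∷ xs) =
        subst (toℕ x <_) (sym (Assigns.length≡ l-assigns)) (FinP.toℕ<n x) VAll.∷ toℕ<-all xs
      row-holds : ∀ {r} → CoveredBy V D r → RowHoldsAt S l r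
      row-holds covers j = let xs , xs≡ , lt∈D = covers j in
        subst (VAll.All (_< length l)) xs≡ (toℕ<-all xs) ,
        trans (cong (S j) (trans (cong (Vec.map (l !_)) (sym xs≡)) (sym (map-w xs))))
              (Equivalence.to (literalQF-sat j xs _) (All.lookup sat lt∈D))

  SatAll : ∀ {V} → Str L → List (QF L V) → (Fin V → ℕ) → Set
  SatAll S φs w = All (λ φ → SatQF S φ w) φs

  ⋀ : ∀ {V} → QF L V → List (QF L V) → QF L V
  ⋀ φ []       = φ
  ⋀ φ (ψ ∷ φs) = and φ (⋀ ψ φs)

  ⋀-sat : ∀ {V} {S} {w : Fin V → ℕ} φ φs → SatQF S (⋀ φ φs) w ⇔ SatAll S (φ ∷ φs) w
  ⋀-sat φ []       = mk⇔ (_∷ []) All.head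
  ⋀-sat φ (ψ ∷ φs) = mk⇔ (λ (Sφ , Sψs) → Sφ ∷ Equivalence.to (⋀-sat ψ φs) Sψs)
                         (λ { (Sφ ∷ Sψs) → Sφ , Equivalence.from (⋀-sat ψ φs) Sψs })

  apart : ∀ {V} (p q : Fin V) → Dec (p ≡ q) → List (QF L V)
  apart p q (yes _) = []
  apart p q (no _)  = neg (eq p q) ∷ []

  apartFrom : ∀ {V} → Fin V → List (QF L V)
  apartFrom {V} p = concatMap (λ q → apart p q (p FinP.≟ q)) (allFin V)

  distinctness : ∀ V → List (QF L V)
  distinctness V = concatMap apartFrom (allFin V)

  distinctness-sat : ∀ {V} {S} {w : Fin V → ℕ} → SatAll S (distinctness V) w ⇔ Separates w
  distinctness-sat {V} {S} {w} = mk⇔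
    (λ sat {p} {q} → apart⇒ p q _ (AllP.tabulate⁻ {n = V} (All-concatMap⁻ (λ q → apart p q _) (allFin V)
      (AllP.tabulate⁻ {n = V} (All-concatMap⁻ apartFrom (allFin V) sat) p)) q))
    (λ separates → All-concatMap⁺ apartFrom (allFin V) (AllP.tabulate⁺ λ p →
      All-concatMap⁺ (λ q → apart p q _) (allFin V) (AllP.tabulate⁺ λ q → ⇒apart p q _ separates)))
    where
    apart⇒ : ∀ (p q : Fin V) d → SatAll S (apart p q d) w → p ≢ q → w p ≢ w q
    apart⇒ p q (yes p≡q) _         p≢q = ⊥-elim (p≢q p≡q)
    apart⇒ p q (no _)    (Sφ ∷ []) _   = Sφ
    ⇒apart : ∀ (p q : Fin V) d → Separates w → SatAll S (apart p q d) w
    ⇒apart p q (yes _)   _         = []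
    ⇒apart p q (no p≢q)  separates = separates p≢q ∷ []

  diagram : ∀ V → List (Literal V) → List (QF L V)
  diagram V D = distinctness V ++ Data.List.map literalQF D

  diagram-sat : ∀ {V} {S} {l} {w : Fin V → ℕ} → Assigns l w → ∀ D →
    SatAll S (diagram V D) w ⇔ (Distinct l × SatLiterals S D w)
  diagram-sat {V} {S} {l} {w} l-assigns D = mk⇔
    (λ sat → let Sdist , Slits = AllP.++⁻ (distinctness V) sat in
      Separates⇒Distinct l-assigns (Equivalence.to distinctness-sat Sdist) , AllP.map⁻ Slits)
    (λ (holds : Distinct l × SatLiterals S D w) →
      AllP.++⁺ (Equivalence.from distinctness-sat (Distinct⇒Separates l-assigns (proj₁ holds)))
               (AllP.map⁺ (proj₂ holds)))

  ∀⋀ : ∀ {N} N′ → List (QF L (N + N′)) → Maybe (Conjunct L 0 N)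
  ∀⋀ N′ []       = nothing
  ∀⋀ N′ (φ ∷ φs) = just (∀[ N′ , 0 , z≤n ] qfΣ (⋀ φ φs))

  ∀¬⋀ : ∀ {N} N′ → List (QF L (N + N′)) → Maybe (Conjunct L 0 N)
  ∀¬⋀ N′ []       = nothing
  ∀¬⋀ N′ (φ ∷ φs) = just (∀[ N′ , 0 , z≤n ] qfΣ (neg (⋀ φ φs)))

  module _ {N} {S : Str L} {ρ : Fin N → ℕ} where

    ∀⋀-intro : ∀ N′ φs → (∀ zs → SatAll S φs (extend ρ zs)) → SatC S (∀⋀ N′ φs) ρ
    ∀⋀-intro N′ []       _   = tt
    ∀⋀-intro N′ (φ ∷ φs) sat zs = Equivalence.from (⋀-sat φ φs) (sat zs)

    ∀⋀-elim : ∀ N′ φs → SatC S (∀⋀ N′ φs) ρ → ∀ zs → SatAll S φs (extend ρ zs)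
    ∀⋀-elim N′ []       _   zs = []
    ∀⋀-elim N′ (φ ∷ φs) sat zs = Equivalence.to (⋀-sat φ φs) (sat zs)

    ∀¬⋀-intro : ∀ N′ φs → (∀ zs → ¬ SatAll S φs (extend ρ zs)) → SatC S (∀¬⋀ N′ φs) ρ
    ∀¬⋀-intro N′ []       _    = tt
    ∀¬⋀-intro N′ (φ ∷ φs) ¬sat zs = ¬sat zs ∘ Equivalence.to (⋀-sat φ φs)

    -- For φs = [] the conjunct is absent, hence says nothing.
    ∀¬⋀-elim : ∀ N′ {φs ψ} → ψ ∈ φs → SatC S (∀¬⋀ N′ φs) ρ → ∀ zs → ¬ SatAll S φs (extend ρ zs)
    ∀¬⋀-elim N′ {φ ∷ φs} _ sat zs = sat zs ∘ Equivalence.from (⋀-sat φ φs)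

-- Informants for copies built in stages

module InformantConstruction (lem : LEM) {L : Sig} (S : Str L) where
  open Diagrams L

  State : Set
  State = Approximation S

  infix 4 _⊑_
  record _⊑_ (s s′ : State) : Set where
    constructor _,_
    field
      rows-≼  : rows s ≼ rows s′
      elems-≼ : elems s ≼ elems s′
  open _⊑_ public

  ⊑-refl : ∀ s → s ⊑ s
  ⊑-refl s = ≼-refl (rows s) , ≼-refl (elems s)

  ⊑-trans : ∀ {s₁ s₂ s₃} → s₁ ⊑ s₂ → s₂ ⊑ s₃ → s₁ ⊑ s₃
  ⊑-trans (r₁ , e₁) (r₂ , e₂) = ≼-trans r₁ r₂ , ≼-trans e₁ e₂

  record Extension (s : State) : Set where
    field
      rows⁺     : List (Row L)
      elems⁺    : List ℕ
      distinct⁺ : Distinct (elems s ++ elems⁺)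
      holds⁺    : All (RowHoldsAt S (elems s ++ elems⁺)) rows⁺
  open Extension public

  extendBy : (s : State) → Extension s → State
  extendBy s x = approximation (rows s ++ rows⁺ x) (elems s ++ elems⁺ x) (distinct⁺ x)
    (AllP.++⁺ (AllRowHoldsAt-++ {S} (elems s) (elems⁺ x) (holds s)) (holds⁺ x))

  extendBy-⊒ : ∀ s x → s ⊑ extendBy s x
  extendBy-⊒ s x = ≼-++ (rows s) (rows⁺ x) , ≼-++ (elems s) (elems⁺ x)

  noExtension : (s : State) → Extension s
  noExtension s = record
    { rows⁺     = []
    ; elems⁺    = []
    ; distinct⁺ = subst Distinct (sym (ListP.++-identityʳ (elems s))) (distinct s)
    ; holds⁺    = []
    }

  append : (s : State) → ∀ v → ¬ Occurs v (elems s) → State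
  append s v fresh = approximation (rows s) (elems s ++ v ∷ []) (Distinct-∷ʳ {elems s} (distinct s) fresh)
    (AllRowHoldsAt-++ {S} (elems s) (v ∷ []) (holds s))

  append-⊒ : ∀ s v fresh → s ⊑ append s v fresh
  append-⊒ s v fresh = ≼-refl (rows s) , ≼-++ (elems s) (v ∷ [])

  include : ℕ → State → State
  include v s with lem (Occurs v (elems s))
  ... | yes _     = s
  ... | no absent = append s v absent

  include-⊒ : ∀ v s → s ⊑ include v s
  include-⊒ v s with lem (Occurs v (elems s))
  ... | yes _     = ⊑-refl s
  ... | no absent = append-⊒ s v absent

  include-occurs : ∀ v s → Occurs v (elems (include v s))
  include-occurs v s with lem (Occurs v (elems s))
  ... | yes occurs = occurs
  ... | no absent  = length (elems s) , ≤-reflexive (sym (ListP.length-++-comm (elems s) (v ∷ []))) ,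
                     nth-length-++ 0 (elems s) v []

  include-rows : ∀ v s → rows (include v s) ≡ rows s
  include-rows v s with lem (Occurs v (elems s))
  ... | yes _ = refl
  ... | no _  = refl

  pad : ℕ → State → State
  pad zero    s = s
  pad (suc t) s = pad t (append s (suc (sum (elems s))) (suc-sum-fresh (elems s)))

  pad-⊒ : ∀ t s → s ⊑ pad t s
  pad-⊒ zero    s = ⊑-refl s
  pad-⊒ (suc t) s = ⊑-trans (append-⊒ s _ (suc-sum-fresh (elems s))) (pad-⊒ t _)

  pad-length : ∀ t s → length (elems (pad t s)) ≡ length (elems s) + t
  pad-length zero    s = sym (+-identityʳ _)
  pad-length (suc t) s = begin
    length (elems (pad t _))      ≡⟨ pad-length t _ ⟩
    length (elems s ++ _ ∷ []) + t ≡⟨ cong (_+ t) (ListP.length-++-comm (elems s) (_ ∷ [])) ⟩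
    suc (length (elems s)) + t     ≡⟨ +-suc (length (elems s)) t ⟨
    length (elems s) + suc t ∎
    where open ≡-Reasoning

  pad-rows : ∀ t s → rows (pad t s) ≡ rows s
  pad-rows zero    s = refl
  pad-rows (suc t) s = pad-rows t _

  row : ℕ → List ℕ → Row L
  row n l j = decodeTuple (Sig.ar L j) n , S j (Vec.map (l !_) (decodeTuple (Sig.ar L j) n))

  decodeTuple-< : ∀ {n l} k → n < l → VAll.All (_< l) (decodeTuple k n)
  decodeTuple-< k n<l = VAll.map (λ x≤n → ≤-<-trans x≤n n<l) (decodeTuple-≤ k ≤-refl)

  addRow : ∀ n (s : State) → n < length (elems s) → State
  addRow n s n<l = approximation (rows s ++ row n (elems s) ∷ []) (elems s) (distinct s)
    (AllP.++⁺ (holds s) ((λ j → decodeTuple-< (Sig.ar L j) n<l , refl) ∷ []))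

  -- Stage n makes n an element, pads so that n codes tuples of positions only, and decides those tuples.
  padding : ℕ → State → ℕ
  padding n s = suc n ∸ length (elems (include n s))

  prepared : ℕ → State → State
  prepared n s = pad (padding n s) (include n s)

  prepared-long : ∀ n s → n < length (elems (prepared n s))
  prepared-long n s = subst (suc n ≤_) (sym (pad-length (padding n s) (include n s)))
                            (m≤n+m∸n (suc n) (length (elems (include n s))))

  prepare : ℕ → State → State
  prepare n s = addRow n (prepared n s) (prepared-long n s)

  prepared-⊒ : ∀ n s → s ⊑ prepared n s
  prepared-⊒ n s = ⊑-trans (include-⊒ n s) (pad-⊒ (padding n s) (include n s))

  prepared-rows : ∀ n s → rows (prepared n s) ≡ rows s
  prepared-rows n s = trans (pad-rows (padding n s) (include n s)) (include-rows n s)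

  noRow : Row L
  noRow j = Vec.replicate _ 0 , false

  module Run (strategy : (s : State) → Extension s) (initial : State) where

    stage : ℕ → State → State
    stage n s = extendBy (prepare n s) (strategy (prepare n s))

    states : ℕ → State
    states zero    = initial
    states (suc n) = stage n (states n)

    prepared-⊑-stage : ∀ n s → prepared n s ⊑ stage n s
    prepared-⊑-stage n s =
      ⊑-trans (≼-++ _ (row n (elems (prepared n s)) ∷ []) , ≼-refl _) (extendBy-⊒ (prepare n s) _)

    stage-⊒ : ∀ n s → s ⊑ stage n s
    stage-⊒ n s = ⊑-trans (prepared-⊒ n s) (prepared-⊑-stage n s)

    states-⊑′ : ∀ {n m} → n ≤′ m → states n ⊑ states m
    states-⊑′ ≤′-refl        = ⊑-refl _
    states-⊑′ (≤′-step n≤′m) = ⊑-trans (states-⊑′ n≤′m) (stage-⊒ _ _)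

    states-⊑ : ∀ {n m} → n ≤ m → states n ⊑ states m
    states-⊑ = states-⊑′ ∘ ≤⇒≤′

    elems-long : ∀ n → n ≤ length (elems (states n))
    elems-long zero    = z≤n
    elems-long (suc n) =
      ≤-trans (prepared-long n (states n)) (≼-length (elems-≼ (prepared-⊑-stage n (states n))))

    rows-after-stage : ∀ n s →
      rows (stage n s) ≡ rows s ++ row n (elems (prepared n s)) ∷ rows⁺ (strategy (prepare n s))
    rows-after-stage n s = begin
      (rows (prepared n s) ++ r ∷ []) ++ rs ≡⟨ ListP.++-assoc (rows (prepared n s)) (r ∷ []) rs ⟩
      rows (prepared n s) ++ r ∷ rs        ≡⟨ cong (_++ r ∷ rs) (prepared-rows n s) ⟩
      rows s ++ r ∷ rs ∎
      where
      open ≡-Reasoning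
      r  = row n (elems (prepared n s))
      rs = rows⁺ (strategy (prepare n s))

    rows-long : ∀ n → n ≤ length (rows (states n))
    rows-long zero    = z≤n
    rows-long (suc n) = subst (λ τ → suc n ≤ length τ) (sym (rows-after-stage n (states n)))
      (≤-trans (s≤s (rows-long n)) (length<length-++-∷ (rows (states n)) _ _))

    module Elems = Limit 0 (elems ∘ states) (elems-≼ ∘ states-⊑) elems-long
    module Rows  = Limit noRow (rows ∘ states) (rows-≼ ∘ states-⊑) rows-long

    f : ℕ → ℕ
    f = Elems.lim

    I : Informant L
    I = Rows.lim

    I-prefix : ∀ n {s} → s ≤ length (rows (states n)) → I [ s ] ≡ take s (rows (states n))
    I-prefix n {s} s≤ = trans (ListP.map-applyUpTo (λ x → x) I s) (Rows.lim-prefix n s≤)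

    f-injective : ∀ x y → f x ≡ f y → x ≡ y
    f-injective x y fx≡fy =
      distinct (states n) x y x<n y<n (trans (Elems.lim-stable n x<n) (trans fx≡fy (sym (Elems.lim-stable n y<n))))
      where
      n = suc (x ⊔ y)
      x<n = ≤-trans (s≤s (m≤m⊔n x y)) (elems-long n)
      y<n = ≤-trans (s≤s (m≤n⊔m x y)) (elems-long n)

    f-surjective : ∀ v → Σ ℕ λ x → f x ≡ v
    f-surjective v =
      let x , x< , elem≡ = Occurs-≼ (elems-≼ include⊑stage) (include-occurs v (states v)) in
      x , trans (sym (Elems.lim-stable (suc v) x<)) elem≡
      where
      include⊑stage : include v (states v) ⊑ states (suc v)
      include⊑stage = ⊑-trans (pad-⊒ (padding v (states v)) _) (prepared-⊑-stage v (states v))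

    f↔ : ℕ ↔ ℕ
    f↔ = mk↔ₛ′ f (proj₁ ∘ f-surjective) (proj₂ ∘ f-surjective)
               (λ x → f-injective _ x (proj₂ (f-surjective (f x))))

    copy : Str L
    copy j a = S j (Vec.map f a)

    copy≅S : copy ≅ S
    copy≅S = f↔ , λ j a → refl

    private
      map-f : ∀ n {k} (a : Vec ℕ k) → VAll.All (_< length (elems (states n))) a →
        Vec.map (elems (states n) !_) a ≡ Vec.map f a
      map-f n = map-cong-below (Elems.lim-stable n)

      I-holds : ∀ m → RowHoldsAt S (elems (states (suc m))) (I m)
      I-holds m = nth-All noRow (rows (states (suc m))) (holds (states (suc m))) (rows-long (suc m))

      I-sound : ∀ m j → copy j (proj₁ (I m j)) ≡ proj₂ (I m j)
      I-sound m j = trans (cong (S j) (sym (map-f (suc m) _ (proj₁ (I-holds m j))))) (proj₂ (I-holds m j))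

      prepared-agrees : ∀ r {k} (a : Vec ℕ k) → VAll.All (_< length (elems (prepared r (states r)))) a →
        Vec.map (elems (prepared r (states r)) !_) a ≡ Vec.map f a
      prepared-agrees r = map-cong-below λ x< →
        trans (sym (nth-≼ 0 prepared≼ x<)) (Elems.lim-stable (suc r) (≤-trans x< (≼-length prepared≼)))
        where prepared≼ = elems-≼ (prepared-⊑-stage r (states r))

      -- The tuple coded by r is decided by the row added at stage r.
      I-complete : ∀ j r → I (length (rows (states r))) j ≡ (decodeTuple (Sig.ar L j) r , copy j (decodeTuple _ r))
      I-complete j r = begin
        I p j                                  ≡⟨ cong (λ ρ → ρ j) (Rows.lim-stable (suc r) p<) ⟨
        nth noRow (rows (states (suc r))) p j ≡⟨ cong (λ τ → nth noRow τ p j) (rows-after-stage r sᵣ) ⟩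
        nth noRow (rows sᵣ ++ rᵣ ∷ rs) p j    ≡⟨ cong (λ ρ → ρ j) (nth-length-++ noRow (rows sᵣ) rᵣ rs) ⟩
        rᵣ j                                   ≡⟨ cong (λ a → t , S j a) (prepared-agrees r t bound) ⟩
        t , copy j t ∎
        where
        open ≡-Reasoning
        sᵣ = states r
        p  = length (rows sᵣ)
        rᵣ = row r (elems (prepared r sᵣ))
        rs = rows⁺ (strategy (prepare r sᵣ))
        t  = decodeTuple (Sig.ar L j) r
        bound : VAll.All (_< length (elems (prepared r sᵣ))) t
        bound = decodeTuple-< (Sig.ar L j) (prepared-long r sᵣ)
        p< : p < length (rows (states (suc r)))
        p< = subst (λ τ → p < length τ) (sym (rows-after-stage r sᵣ)) (length<length-++-∷ (rows sᵣ) rᵣ rs)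

    I-informs : IsInformantFor I copy
    I-informs j a b = mk⇔
      (λ (m , Imj≡) → subst (λ (a , b) → copy j a ≡ b) Imj≡ (I-sound m j))
      (λ copy≡ → let r , r≡ = decodeTuple-surjective a in
        length (rows (states r)) , trans (I-complete j r) (cong₂ _,_ r≡ (trans (cong (copy j) r≡) copy≡)))

-- (1) ⇒ (2): sentences from locking sequences

module SentencesFromLearner (lem : LEM) {L : Sig} (M : Learner L) where
  open Diagrams L

  Locks : ∀ {S} → Approximation S → ℕ → Set
  Locks {S} σ e = ∀ z̄ τ′ → Distinct (elems σ ++ z̄) → All (RowHoldsAt S (elems σ ++ z̄)) τ′ →
    M (rows σ ++ τ′) ≡ just e

  LocksNonempty : ∀ {S} → Approximation S → ℕ → Set
  LocksNonempty {S} σ e = ∀ z̄ r τ′ → Distinct (elems σ ++ z̄) → All (RowHoldsAt S (elems σ ++ z̄)) (r ∷ τ′) →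
    M (rows σ ++ r ∷ τ′) ≡ just e

  -- ∃ x̄ (x̄ is distinct ∧ τ holds of x̄ ∧ ⋀ { ∀ z̄ ¬ D(x̄ z̄) : D covers some τ′ with M (τ ++ τ′) ≠ e })
  module LockingSentence {S₀ : Str L} (σ : Approximation S₀) (e : ℕ) where

    N : ℕ
    N = length (elems σ)

    Spoils : ∀ N′ → List (Literal (N + N′)) → Set
    Spoils N′ D = Σ (List (Row L)) λ τ′ → All (CoveredBy (N + N′) D) τ′ × M (rows σ ++ τ′) ≢ just e

    Pattern : Set
    Pattern = Σ ℕ λ N′ → List (Literal (N + N′))

    patterns : Countable Pattern
    patterns = Σ-countable ℕ-countable (λ N′ → List-countable (Literal-countable (N + N′)))

    spoilerConjunct : Maybe Pattern → Maybe (Conjunct L 0 N)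
    spoilerConjunct nothing = nothing
    spoilerConjunct (just (N′ , D)) with lem (Spoils N′ D)
    ... | yes _ = ∀¬⋀ N′ (diagram (N + N′) D)
    ... | no _  = nothing

    conjuncts : ℕ → Maybe (Conjunct L 0 N)
    conjuncts zero    = ∀⋀ 0 (diagram (N + 0) (literals (N + 0) (rows σ)))
    conjuncts (suc c) = spoilerConjunct (decode patterns c)

    disjuncts : ℕ → Maybe (Disjunct L 1 0)
    disjuncts zero    = just (∃[ N , 1 , s≤s z≤n ] ⋀∀ conjuncts)
    disjuncts (suc _) = nothing

    sentence : Σ2Sentence L
    sentence = ⋁∃ disjuncts

    sentence-true : Locks σ e → S₀ ⊨ sentence
    sentence-true locks = 0 , ys , conjunct-true
      where
      ys = Vec.fromList (elems σ)
      ρ  = extend noVars ys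

      ρ-assigns : Assigns (elems σ) ρ
      ρ-assigns = Assigns-cast (VecP.toList∘fromList (elems σ)) (Assigns-extend ys Assigns-noVars)

      spoiler-true : ∀ m → SatC S₀ (spoilerConjunct m) ρ
      spoiler-true nothing = tt
      spoiler-true (just (N′ , D)) with lem (Spoils N′ D)
      ... | no _ = tt
      ... | yes (τ′ , covered , moved) = ∀¬⋀-intro N′ (diagram (N + N′) D) λ zs sat →
        let ext-assigns = Assigns-extend zs ρ-assigns
            distinct′ , Slits = Equivalence.to (diagram-sat ext-assigns D) sat in
        moved (locks (Vec.toList zs) τ′ distinct′ (covered-holds ext-assigns τ′ covered Slits))

      conjunct-true : ∀ c → SatC S₀ (conjuncts c) ρ
      conjunct-true zero    = ∀⋀-intro 0 (diagram (N + 0) _) λ { [] →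
        let ext-assigns = Assigns-cast (ListP.++-identityʳ (elems σ)) (Assigns-extend [] ρ-assigns) in
        Equivalence.from (diagram-sat ext-assigns _) (distinct σ , literals-hold ext-assigns (rows σ) (holds σ)) }
      conjunct-true (suc c) = spoiler-true (decode patterns c)

    spoilerConjunct-spoils : ∀ {S} {ρ : Fin N → ℕ} N′ D → Spoils N′ D →
      SatC S (spoilerConjunct (just (N′ , D))) ρ → SatC S (∀¬⋀ N′ (diagram (N + N′) D)) ρ
    spoilerConjunct-spoils N′ D spoils sat with lem (Spoils N′ D)
    ... | yes _      = sat
    ... | no ¬spoils = ⊥-elim (¬spoils spoils)

    sentence-locks : ∀ {S} → All (RowBelow N) (rows σ) → S ⊨ sentence →
      Σ (Approximation S) λ σ′ → LocksNonempty σ′ e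
    sentence-locks {S} below (zero , ys , conjunct-true) =
      approximation (rows σ) b̄ (proj₁ base) (proj₂ base) , locks
      where
      b̄ = Vec.toList ys
      ρ = extend noVars ys

      b̄-assigns : Assigns b̄ ρ
      b̄-assigns = Assigns-extend ys Assigns-noVars

      base : Distinct b̄ × All (RowHoldsAt S b̄) (rows σ)
      base =
        let ext-assigns = Assigns-cast (ListP.++-identityʳ b̄) (Assigns-extend [] b̄-assigns)
            distinct′ , Slits = Equivalence.to (diagram-sat ext-assigns _) (∀⋀-elim 0 _ (conjunct-true 0) [])
            below′ = subst (λ V → All (RowBelow V) (rows σ)) (sym (+-identityʳ N)) below in
        distinct′ , covered-holds ext-assigns (rows σ) (literals-cover (N + 0) (rows σ) below′) Slits

      locks : ∀ z̄ r τ′ → Distinct (b̄ ++ z̄) → All (RowHoldsAt S (b̄ ++ z̄)) (r ∷ τ′) →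
        M (rows σ ++ r ∷ τ′) ≡ just e
      locks z̄ r τ′ distinct′ holds′ = decidable-stable (lem _) λ moved →
        ∀¬⋀-elim N′ member (spoilerConjunct-spoils N′ D (r ∷ τ′ , covered , moved) spoiler-true) zs
          (Equivalence.from (diagram-sat ext-assigns D) (distinct′ , literals-hold ext-assigns (r ∷ τ′) holds′))
        where
        N′ = length z̄
        zs = Vec.fromList z̄
        ext-assigns : Assigns (b̄ ++ z̄) (extend ρ zs)
        ext-assigns = Assigns-cast (cong (b̄ ++_) (VecP.toList∘fromList z̄)) (Assigns-extend zs b̄-assigns)
        D = literals (N + N′) (r ∷ τ′)
        covered : All (CoveredBy (N + N′) D) (r ∷ τ′)
        covered = literals-cover (N + N′) (r ∷ τ′)
          (All.map (RowHoldsAt⇒RowBelow {S} {b̄ ++ z̄} (Assigns.length≡ ext-assigns)) holds′)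
        member = ∈-++⁺ʳ (distinctness (N + N′)) (∈-map⁺ literalQF (proj₂ (proj₂ (All.head covered Fin.zero))))
        spoiler-true : SatC S (spoilerConjunct (just (N′ , D))) ρ
        spoiler-true = let c , c≡ = decode-surjective patterns (N′ , D) in
          subst (λ m → SatC S (spoilerConjunct m) ρ) c≡ (conjunct-true (suc c))

  Identifies : (ℕ → Str L) → (Str L → Set) → Set
  Identifies ν C = (A : Str L) → C A → (I : Informant L) → IsInformantFor I A →
    Σ ℕ λ e → Σ ℕ λ s₀ → (ν e ≅ A) × ((s : ℕ) → s₀ ≤ s → M (I [ s ]) ≡ just e)

  LockingSequence : (ℕ → Str L) → Str L → Set
  LockingSequence ν S = Σ (Approximation S) λ σ → Σ ℕ λ e → ν e ≅ S × Locks σ e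

  module _ {ν : ℕ → Str L} {B : ℕ → Str L} (M-identifies : Identifies ν (GeneratedBy B)) where

    module Spoiling (i : ℕ) (no-locking-sequence : ¬ LockingSequence ν (B i)) where
      open InformantConstruction lem (B i)

      Correct : State → ℕ → Set
      Correct s e = M (rows s) ≡ just e × ν e ≅ B i

      Moves : (s : State) → ℕ → Extension s → Set
      Moves s e x = M (rows s ++ rows⁺ x) ≢ just e

      spoiler : (s : State) → Extension s
      spoiler s with lem (Σ ℕ (Correct s))
      ... | no _        = noExtension s
      ... | yes (e , _) with lem (Σ (Extension s) (Moves s e))
      ...   | yes (x , _) = x
      ...   | no _        = noExtension s

      spoiler-moves : ∀ s e → Correct s e → Moves s e (spoiler s)
      spoiler-moves s e correct with lem (Σ ℕ (Correct s))
      ... | no none = ⊥-elim (none (e , correct))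
      ... | yes (e′ , correct′) with lem (Σ (Extension s) (Moves s e′))
      ...   | yes (x , moves) =
        subst (λ e → Moves s e x) (MaybeP.just-injective (trans (sym (proj₁ correct′)) (proj₁ correct))) moves
      ...   | no stuck = ⊥-elim (no-locking-sequence (s , e′ , proj₂ correct′ , locks))
        where
        locks : Locks s e′
        locks z̄ τ′ d h = decidable-stable (lem _) λ moved →
          stuck (record { rows⁺ = τ′ ; elems⁺ = z̄ ; distinct⁺ = d ; holds⁺ = h } , moved)

      open Run spoiler (approximation [] [] Distinct-[] [])

      -- M converges on the informant I for copy, yet the spoiler moves it off every correct conjecture.
      contradiction : ⊥
      contradiction = spoiler-moves s e (M-on-s , ν≅B) M-after-spoiler
        where
        learned = M-identifies copy (i , ≅-sym {A = copy} {B i} copy≅S) I I-informs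
        e  = proj₁ learned
        s₀ = proj₁ (proj₂ learned)
        ν≅B : ν e ≅ B i
        ν≅B = ≅-trans {A = ν e} {copy} {B i} (proj₁ (proj₂ (proj₂ learned))) copy≅S
        converges = proj₂ (proj₂ (proj₂ learned))
        s  = prepare s₀ (states s₀)
        τ₁ = rows s
        τ₂ = rows⁺ (spoiler s)
        s₀≤τ₁ : s₀ ≤ length τ₁
        s₀≤τ₁ = ≤-trans (rows-long s₀) (subst (λ τ → length τ ≤ length τ₁) (prepared-rows s₀ (states s₀))
          (ListP.length-++-≤ˡ (rows (prepared s₀ (states s₀))) {row s₀ (elems (prepared s₀ (states s₀))) ∷ []}))
        τ₁≤τ₁τ₂ : length τ₁ ≤ length (τ₁ ++ τ₂)
        τ₁≤τ₁τ₂ = ListP.length-++-≤ˡ τ₁ {τ₂}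
        M-on-s : M τ₁ ≡ just e
        M-on-s = begin
          M τ₁                             ≡⟨ cong M (take-length-++ τ₁ τ₂) ⟨
          M (take (length τ₁) (τ₁ ++ τ₂)) ≡⟨ cong M (I-prefix (suc s₀) τ₁≤τ₁τ₂) ⟨
          M (I [ length τ₁ ])             ≡⟨ converges (length τ₁) s₀≤τ₁ ⟩
          just e ∎
          where open ≡-Reasoning
        M-after-spoiler : M (τ₁ ++ τ₂) ≡ just e
        M-after-spoiler = begin
          M (τ₁ ++ τ₂)                              ≡⟨ cong M (ListP.take-all (length (τ₁ ++ τ₂)) (τ₁ ++ τ₂) ≤-refl) ⟨
          M (take (length (τ₁ ++ τ₂)) (τ₁ ++ τ₂)) ≡⟨ cong M (I-prefix (suc s₀) ≤-refl) ⟨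
          M (I [ length (τ₁ ++ τ₂) ])             ≡⟨ converges (length (τ₁ ++ τ₂)) (≤-trans s₀≤τ₁ τ₁≤τ₁τ₂) ⟩
          just e ∎
          where open ≡-Reasoning

    lockingSequence : ∀ i → LockingSequence ν (B i)
    lockingSequence i = decidable-stable (lem _) (Spoiling.contradiction i)

    locked-conjecture-correct : ∀ {S} → GeneratedBy B S → (σ : Approximation S) → ∀ {e} →
      LocksNonempty σ e → ν e ≅ S
    locked-conjecture-correct {S} (i , Bi≅S) σ {e} locks =
      subst (λ e → ν e ≅ S) (MaybeP.just-injective (trans (sym (converges s s₀≤s)) M-locked))
            (≅-trans {A = ν (proj₁ learned)} {copy} {S} (proj₁ (proj₂ (proj₂ learned))) copy≅S)
      where
      open InformantConstruction lem S
      open Run noExtension σ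
      learned = M-identifies copy (i , ≅-trans {A = B i} {S} {copy} Bi≅S (≅-sym {A = copy} {S} copy≅S))
                             I I-informs
      s₀ = proj₁ (proj₂ learned)
      converges = proj₂ (proj₂ (proj₂ learned))
      s = length (rows σ) + suc s₀
      s₀≤s : s₀ ≤ s
      s₀≤s = ≤-trans (n≤1+n s₀) (m≤n+m (suc s₀) (length (rows σ)))

      locked : ∀ x y → Distinct (elems σ ++ y) → All (RowHoldsAt S (elems σ ++ y)) (rows σ ++ x) →
        s ≤ length (rows σ ++ x) → M (take s (rows σ ++ x)) ≡ just e
      locked []      y d h long = ⊥-elim (<⇒≱ (≤-trans (m<m+n (length (rows σ)) z<s) long)
                                           (≤-reflexive (cong length (ListP.++-identityʳ (rows σ)))))
      locked (r ∷ x) y d h long =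
        trans (cong M (take-++ (rows σ) (r ∷ x) (suc s₀)))
              (locks y r (take s₀ x) d (AllP.take⁺ (suc s₀) (AllP.++⁻ʳ (rows σ) h)))

      prefix-locked : ∀ t → σ ⊑ t → s ≤ length (rows t) → M (take s (rows t)) ≡ just e
      prefix-locked (approximation _ _ d h) ((x , refl) , (y , refl)) = locked x y d h

      M-locked : M (I [ s ]) ≡ just e
      M-locked = trans (cong M (I-prefix s (rows-long s))) (prefix-locked (states s) (states-⊑ z≤n) (rows-long s))

    module _ (i : ℕ) where
      private
        locking = lockingSequence i
        σ    = proj₁ locking
        e    = proj₁ (proj₂ locking)
        ν≅Bi = proj₁ (proj₂ (proj₂ locking))
        locks = proj₂ (proj₂ (proj₂ locking))

      sentence : Σ2Sentence L
      sentence = LockingSentence.sentence σ e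

      sentence-true : B i ⊨ sentence
      sentence-true = LockingSentence.sentence-true σ e locks

      sentence-identifies : (∀ i j → i ≢ j → ¬ (B i ≅ B j)) → ∀ j → B j ⊨ sentence → i ≡ j
      sentence-identifies B-distinct j sat = decidable-stable (i ≟ j) λ i≢j →
        B-distinct i j i≢j (≅-trans {A = B i} {ν e} {B j} (≅-sym {A = ν e} {B i} ν≅Bi) ν≅Bj)
        where
        below = All.map (RowHoldsAt⇒RowBelow {B i} {elems σ} refl) (holds σ)
        locked = LockingSentence.sentence-locks σ e below sat
        ν≅Bj : ν e ≅ B j
        ν≅Bj = locked-conjecture-correct (j , ≅-refl {A = B j}) (proj₁ locked) (proj₂ locked)

theorem3p1 : LEM → (L : Sig) (K₀ : Str L → Set) → ClosedUnderIso K₀ →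
    (ν : ℕ → Str L) → EffectiveEnumeration K₀ ν →
    (B : ℕ → Str L) → ((i : ℕ) → K₀ (B i)) →
    ((i j : ℕ) → i ≢ j → ¬ (B i ≅ B j)) →
    InfExLearnable (GeneratedBy B) ν ⇔
      (Σ (ℕ → Σ2Sentence L) λ ψ → (i j : ℕ) → (B j ⊨ ψ i) ⇔ (i ≡ j))
theorem3p1 lem L K₀ _ ν (_ , _ , enumerates) B B∈K₀ B-distinct = mk⇔ learnable⇒sentences sentences⇒learnable
  where
  Characterising : Set
  Characterising = Σ (ℕ → Σ2Sentence L) λ ψ → (i j : ℕ) → (B j ⊨ ψ i) ⇔ (i ≡ j)

  learnable⇒sentences : InfExLearnable (GeneratedBy B) ν → Characterising
  learnable⇒sentences (M , M-identifies) =
    sentence M-identifies , λ i j →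
      mk⇔ (sentence-identifies M-identifies i B-distinct j) λ { refl → sentence-true M-identifies i }
    where open SentencesFromLearner lem M using (sentence; sentence-true; sentence-identifies)

  sentences⇒learnable : Characterising → InfExLearnable (GeneratedBy B) ν
  sentences⇒learnable (ψ , ψ-characterises) = learner , learns
    where
    index : ℕ → ℕ
    index i = proj₁ (enumerates (B i) (B∈K₀ i))
    open LearnerFromSentences lem ν B index (λ i → proj₂ (enumerates (B i) (B∈K₀ i))) ψ ψ-characterises
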